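{- For a finite set $D$ of cells $(i,j)$ (row $i$ from top, column $j$ from left) with $|D|=N$, a standard filling of $D$ is a bijection $T:D\to\{1,\dots,N\}$ such that $T(i,j)<T(i,j')$ whenever $(i,j),(i,j')\in D$ with $j<j'$, and $T(i,j)<T(i',j)$ whenever $(i,j),(i',j)\in D$ with $i<i'$ (i.e. entries increase along every row and down every column, comparing all cells of $D$ in that row/column). Then: (1) For integers $m\ge1$, $0\le k\le m$, let $D$ consist of $m$ cells $(1,1),\dots,(1,m)$ in row 1, $m+1$ cells $(2,1),\dots,(2,m+1)$ in row 2, and $m-k$ cells $(3,1),\dots,(3,m-k)$ in row 3 (the shape $(m+1,m+1,m-k)$ with its north-east corner cell removed). The number of standard fillings of $D$ is $$f_{m,m+1,m-k}=\binom{3m-k+1}{m,\ m+1,\ m-k}\frac{(k+2)^2(2m+1)+(m+2)}{(m+1)(m+2)(2m+1)(2m+3)}.$$ (2) For integers $m\ge2$, $k\ge0$, let $D$ consist of cells $(1,1),\dots,(1,m+k)$, $(2,1),\dots,(2,m-1)$, $(3,1),\dots,(3,m)$ (the shape $(m+k,m,m)$ with the last cell of the second row removed). The number of standard fillings of $D$ is $$f_{m+k,m-1,m}=\frac{1}{(2m-1)(2m-3)}\left[\frac{(k+2)^2(2m-3)+m}{(m+k+2)(m+k+1)}\binom{3m+k-1}{m+k,\ m-1,\ m}-\frac{3}{3m-1}\binom{3m-1}{m+1,\ m-2,\ m}\right].$$ (3) For an integer $m\ge0$, let $D$ consist of cells $(1,1),\dots,(1,m+3)$, $(2,1),(2,3)$,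 $(3,1),(3,2),(3,3)$ (the shape $(m+3,3,3)$ with the middle cell of the second row removed). The number of standard fillings of $D$ is $$f_{m+3,2,3}(-1)=\frac{m+5}{10}\binom{m+2}{2}\binom{m+9}{2}.$$
   Context: $\binom{a}{b,c,d}=\frac{a!}{b!\,c!\,d!}$ denotes the multinomial coefficient (with $b+c+d=a$). In part (3) the column condition applies across the removed cell: the entry in cell $(1,2)$ must be smaller than the entry in cell $(3,2)$. -}

module Defs where

open import Data.Nat using (ℕ; zero; suc; _+_; _*_; _∸_; _≤_; _<_; _/_; NonZero)
open import Data.Nat.Properties using (_!≢0; m*n≢0; _!*_!≢0)
open import Data.Nat.Combinatorics using ()
open import Data.Nat.Base using (_!)
open import Data.Product using (_×_; _,_; proj₁; proj₂; Σ)
open import Data.List using (List; []; _∷_; map; upTo; _++_; length)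
open import Data.List.Relation.Unary.Unique.Propositional using (Unique)
open import Data.List.Membership.Propositional using (_∈_)
open import Data.Vec using (Vec; lookup; fromList)
open import Data.Fin using (Fin)
open import Relation.Binary.PropositionalEquality using (_≡_)
open import Function.Bundles using (_⇔_)

multinomial : ℕ → ℕ → ℕ → ℕ
multinomial b c d = ((b + c + d) !) / (b ! * c ! * d !)
  where instance
    _ = d !≢0
    _ = b !* c !≢0
    _ = m*n≢0 (b ! * c !) (d !)

-- A cell (i , j) : row i (from top), column j (from left), 1-based.
Cell : Set
Cell = ℕ × ℕ

row col : Cell → ℕ
row = proj₁
col = proj₂

rowCells : ℕ → ℕ → List Cell
rowCells i len = map (λ j → (i , suc j)) (upTo len)

-- A diagram D is given as a duplicate-free list of its cells; a filling
-- T : D → ℕ is given as the vector of its values, in the order of the list.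
Diagram : Set
Diagram = List Cell

Filling : Diagram → Set
Filling D = Vec ℕ (length D)

IsStandardFilling : (D : Diagram) → Filling D → Set
IsStandardFilling D T =
    (∀ p → 1 ≤ lookup T p × lookup T p ≤ length D)
  × (∀ p q → lookup T p ≡ lookup T q → p ≡ q)
  × (∀ p q → row (c p) ≡ row (c q) → col (c p) < col (c q) → lookup T p < lookup T q)
  × (∀ p q → col (c p) ≡ col (c q) → row (c p) < row (c q) → lookup T p < lookup T q)
  where
  c : Fin (length D) → Cell
  c = lookup (fromList D)

NumStandardFillings : Diagram → ℕ → Set
NumStandardFillings D n =
  Σ (List (Filling D)) λ L →
      Unique L
    × (∀ T → (IsStandardFilling D T ⇔ T ∈ L))
    × length L ≡ n

D₁ : ℕ → ℕ → Diagram
D₁ m k = rowCells 1 m ++ rowCells 2 (suc m) ++ rowCells 3 (m ∸ k)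

D₂ : ℕ → ℕ → Diagram
D₂ m k = rowCells 1 (m + k) ++ rowCells 2 (m ∸ 1) ++ rowCells 3 m

D₃ : ℕ → Diagram
D₃ m = rowCells 1 (m + 3) ++ ((2 , 1) ∷ (2 , 3) ∷ []) ++ rowCells 3 3

module Submission where

-- The largest entry of a standard filling of D sits in a corner of D (no
-- cell of D right of it in its row or below it in its column), and
-- erasing it leaves a standard filling of the other cells.  So standard
-- fillings are counted by "peelings": the ways to delete the cells one at
-- a time, always deleting a corner (module Fillings, for any diagram).  In parts (1) and (2) one
-- deletion leaves a partition, so the count is a sum of hook length terms,
-- summed in closed form by induction on a row length.  In part (3) all
-- counts involved are polynomials in the length of row 1, found by
-- induction from the same recurrence.

module Fillings where

  open import Defs
  open import Data.Nat using (ℕ; zero; suc; _+_; _≤_; _<_; _≟_; _<?_; z≤n; s≤s; pred)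
  open import Data.Nat.Properties using (≤-refl; <⇒≢; ≤⇒≯; m≤n⇒m≤1+n; ≤∧≢⇒<; m<1+n⇒m≤n)
  open import Data.Nat.ListAction using (sum)
  open import Data.Fin as Fin using (Fin; punchIn; punchOut; toℕ; fromℕ<)
  import Data.Fin.Properties as FinP
  open import Data.Fin.Properties using (punchIn-injective; punchInᵢ≢i; punchIn-punchOut; any?; pigeonhole; toℕ-fromℕ<)
  open import Data.Vec using (Vec; []; _∷_; lookup; insertAt; removeAt; toList; fromList)
  open import Data.Vec.Properties using (insertAt-lookup; insertAt-punchIn; removeAt-insertAt; insertAt-removeAt; toList∘fromList)
  import Data.Vec.Relation.Unary.All.Properties as VecAll
  open import Data.List using (List; []; _∷_; _++_; [_]; length; map; concat; tabulate)
  open import Data.List.Properties using (length-++; length-map; ++-assoc; ++-identityʳ; tabulate-cong)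
  open import Data.List.Relation.Unary.All as All using (All)
  import Data.List.Relation.Unary.All.Properties as AllP
  import Data.List.Relation.Unary.Any.Properties as AnyP
  open import Data.List.Relation.Unary.Any using (here)
  open import Data.List.Relation.Unary.AllPairs using ([]; _∷_)
  import Data.List.Relation.Unary.AllPairs.Properties as AllPairsP
  open import Data.List.Relation.Unary.Unique.Propositional using (Unique)
  import Data.List.Relation.Unary.Unique.Propositional.Properties as UniqueP
  open import Data.List.Membership.Propositional using (_∈_)
  open import Data.List.Membership.Propositional.Properties using (∈-concat⁻; ∈-concat⁺; ∈-map⁻; ∈-map⁺)
  open import Data.List.Relation.Binary.Disjoint.Propositional using (Disjoint)
  open import Data.Product using (_×_; _,_; proj₁; proj₂; ∃)
  open import Data.Sum using (_⊎_; inj₁; inj₂)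
  open import Relation.Nullary using (Dec; yes; no; ¬_; contradiction)
  open import Relation.Nullary.Decidable using (_×-dec_; _⊎-dec_; ¬?)
  open import Relation.Binary.PropositionalEquality using (_≡_; _≢_; refl; sym; trans; cong; cong₂; subst; subst₂)
  open Relation.Binary.PropositionalEquality.≡-Reasoning
  open import Function using (_∘_)
  open import Function.Bundles using (_⇔_; mk⇔; Equivalence)

  _◁_ : Cell → Cell → Set
  x ◁ y = (row x ≡ row y × col x < col y) ⊎ (col x ≡ col y × row x < row y)

  _◁?_ : ∀ x y → Dec (x ◁ y)
  x ◁? y = ((row x ≟ row y) ×-dec (col x <? col y)) ⊎-dec ((col x ≟ col y) ×-dec (row x <? row y))

  -- x is a corner of D: no cell of D lies after x in the order ◁.  The
  -- largest entry of a standard filling always sits in a corner.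
  IsCorner : Cell → List Cell → Set
  IsCorner x D = All (λ y → ¬ x ◁ y) D

  isCorner? : ∀ x D → Dec (IsCorner x D)
  isCorner? x D = All.all? (λ y → ¬? (x ◁? y)) D

  onlyIf : {P A : Set} → Dec P → List A → List A
  onlyIf (yes _) xs = xs
  onlyIf (no _)  _  = []

  onlyIfℕ : {P : Set} → Dec P → ℕ → ℕ
  onlyIfℕ (yes _) k = k
  onlyIfℕ (no _)  _ = 0

  onlyIf-∈ : {P A : Set} (d : Dec P) (xs : List A) {v : A} → v ∈ onlyIf d xs → P × v ∈ xs
  onlyIf-∈ (yes p) xs v∈ = p , v∈

  onlyIf-yes : {P A : Set} (d : Dec P) (xs : List A) → P → onlyIf d xs ≡ xs
  onlyIf-yes (yes _) xs _ = refl
  onlyIf-yes (no ¬p) xs p = contradiction p ¬p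

  onlyIf-unique : {P A : Set} (d : Dec P) {xs : List A} → Unique xs → Unique (onlyIf d xs)
  onlyIf-unique (yes _) u = u
  onlyIf-unique (no _)  _ = []

  onlyIfℕ-yes : {P : Set} (d : Dec P) (k : ℕ) → P → onlyIfℕ d k ≡ k
  onlyIfℕ-yes (yes _) k _ = refl
  onlyIfℕ-yes (no ¬p) k p = contradiction p ¬p

  onlyIfℕ-no : {P : Set} (d : Dec P) (k : ℕ) → ¬ P → onlyIfℕ d k ≡ 0
  onlyIfℕ-no (yes p) k ¬p = contradiction p ¬p
  onlyIfℕ-no (no _)  k _  = refl

  onlyIfℕ-⇔ : {P Q : Set} (d : Dec P) (d' : Dec Q) (k : ℕ) → P ⇔ Q → onlyIfℕ d k ≡ onlyIfℕ d' k
  onlyIfℕ-⇔ (yes _) (yes _) k _   = refl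
  onlyIfℕ-⇔ (yes p) (no ¬q) k p⇔q = contradiction (Equivalence.to p⇔q p) ¬q
  onlyIfℕ-⇔ (no ¬p) (yes q) k p⇔q = contradiction (Equivalence.from p⇔q q) ¬p
  onlyIfℕ-⇔ (no _)  (no _)  k _   = refl

  length-onlyIf : {P A : Set} (d : Dec P) (xs : List A) → length (onlyIf d xs) ≡ onlyIfℕ d (length xs)
  length-onlyIf (yes _) xs = refl
  length-onlyIf (no _)  xs = refl

  record IsStandard {n : ℕ} (cs : Vec Cell n) (T : Vec ℕ n) : Set where
    field
      bounded   : ∀ p → 1 ≤ lookup T p × lookup T p ≤ n
      injective : ∀ p q → lookup T p ≡ lookup T q → p ≡ q
      monotone  : ∀ p q → lookup cs p ◁ lookup cs q → lookup T p < lookup T q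

  isStandard⇔ : ∀ D T → IsStandardFilling D T ⇔ IsStandard (fromList D) T
  isStandard⇔ D T = mk⇔ to from
    where
    to : IsStandardFilling D T → IsStandard (fromList D) T
    to (bnd , inj , rows , cols) = record
      { bounded = bnd ; injective = inj
      ; monotone = λ { p q (inj₁ (e , l)) → rows p q e l ; p q (inj₂ (e , l)) → cols p q e l } }
    from : IsStandard (fromList D) T → IsStandardFilling D T
    from st = bounded , injective , (λ p q e l → monotone p q (inj₁ (e , l))) , (λ p q e l → monotone p q (inj₂ (e , l)))
      where open IsStandard st

  corner⇒ : ∀ {n} (cs : Vec Cell n) p → IsCorner (lookup cs p) (toList cs) → ∀ q → ¬ lookup cs p ◁ lookup cs q
  corner⇒ cs p corner = VecAll.lookup⁺ (VecAll.toList⁻ corner)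

  corner⇐ : ∀ {n} (cs : Vec Cell n) p → (∀ q → ¬ lookup cs p ◁ lookup cs q) → IsCorner (lookup cs p) (toList cs)
  corner⇐ cs p free = VecAll.toList⁺ (VecAll.lookup⁻ free)

  lookup-removeAt : ∀ {A : Set} {n} (xs : Vec A (suc n)) p j → lookup (removeAt xs p) j ≡ lookup xs (punchIn p j)
  lookup-removeAt (x ∷ xs)     Fin.zero    j           = refl
  lookup-removeAt (x ∷ y ∷ ys) (Fin.suc p) Fin.zero    = refl
  lookup-removeAt (x ∷ y ∷ ys) (Fin.suc p) (Fin.suc j) = lookup-removeAt (y ∷ ys) p j

  data Position {n : ℕ} (p : Fin (suc n)) : Fin (suc n) → Set where
    at    : Position p p
    other : (j : Fin n) → Position p (punchIn p j)

  position : ∀ {n} (p q : Fin (suc n)) → Position p q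
  position p q with q Fin.≟ p
  ... | yes refl = at
  ... | no q≢p = subst (Position p) (punchIn-punchOut (q≢p ∘ sym)) (other (punchOut (q≢p ∘ sym)))

  placeLargest-standard : ∀ {n} (cs : Vec Cell (suc n)) p (T : Vec ℕ n) →
    IsCorner (lookup cs p) (toList cs) → IsStandard (removeAt cs p) T → IsStandard cs (insertAt T p (suc n))
  placeLargest-standard {n} cs p T corner st = record { bounded = bnd ; injective = inj ; monotone = mono }
    where
    open IsStandard st
    T⁺ : Vec ℕ (suc n)
    T⁺ = insertAt T p (suc n)
    top : lookup T⁺ p ≡ suc n
    top = insertAt-lookup T p (suc n)
    rest : ∀ j → lookup T⁺ (punchIn p j) ≡ lookup T j
    rest = insertAt-punchIn T p (suc n)
    below-top : ∀ j → lookup T⁺ (punchIn p j) < suc n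
    below-top j rewrite rest j = s≤s (proj₂ (bounded j))
    bnd : ∀ q → 1 ≤ lookup T⁺ q × lookup T⁺ q ≤ suc n
    bnd q with position p q
    ... | at      rewrite top    = s≤s z≤n , ≤-refl
    ... | other j rewrite rest j = proj₁ (bounded j) , m≤n⇒m≤1+n (proj₂ (bounded j))
    inj : ∀ q r → lookup T⁺ q ≡ lookup T⁺ r → q ≡ r
    inj q r e with position p q | position p r
    ... | at      | at      = refl
    ... | at      | other k = contradiction (trans (sym e) top) (<⇒≢ (below-top k))
    ... | other j | at      = contradiction (trans e top) (<⇒≢ (below-top j))
    ... | other j | other k = cong (punchIn p) (injective j k (trans (sym (rest j)) (trans e (rest k))))
    mono : ∀ q r → lookup cs q ◁ lookup cs r → lookup T⁺ q < lookup T⁺ r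
    mono q r q◁r with position p q | position p r
    ... | at      | _       = contradiction q◁r (corner⇒ cs p corner r)
    ... | other j | at      rewrite top = below-top j
    ... | other j | other k rewrite rest j | rest k =
      monotone j k (subst₂ _◁_ (sym (lookup-removeAt cs p j)) (sym (lookup-removeAt cs p k)) q◁r)

  largest-at-corner : ∀ {n} {cs : Vec Cell (suc n)} {T} p → IsStandard cs T → lookup T p ≡ suc n →
    IsCorner (lookup cs p) (toList cs)
  largest-at-corner {cs = cs} {T} p st top = corner⇐ cs p λ q p◁q →
    ≤⇒≯ (proj₂ (bounded q)) (subst (_< lookup T q) top (monotone p q p◁q))
    where open IsStandard st

  removeLargest-standard : ∀ {n} {cs : Vec Cell (suc n)} {T} p → IsStandard cs T → lookup T p ≡ suc n →
    IsStandard (removeAt cs p) (removeAt T p)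
  removeLargest-standard {n} {cs} {T} p st top = record { bounded = bnd ; injective = inj ; monotone = mono }
    where
    open IsStandard st
    rest : ∀ j → lookup (removeAt T p) j ≡ lookup T (punchIn p j)
    rest = lookup-removeAt T p
    bnd : ∀ j → 1 ≤ lookup (removeAt T p) j × lookup (removeAt T p) j ≤ n
    bnd j rewrite rest j = proj₁ (bounded (punchIn p j)) , m<1+n⇒m≤n (≤∧≢⇒< (proj₂ (bounded (punchIn p j))) not-top)
      where
      not-top : lookup T (punchIn p j) ≢ suc n
      not-top e = punchInᵢ≢i p j (injective _ _ (trans e (sym top)))
    inj : ∀ j k → lookup (removeAt T p) j ≡ lookup (removeAt T p) k → j ≡ k
    inj j k e = punchIn-injective p j k (injective _ _ (trans (sym (rest j)) (trans e (rest k))))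
    mono : ∀ j k → lookup (removeAt cs p) j ◁ lookup (removeAt cs p) k → lookup (removeAt T p) j < lookup (removeAt T p) k
    mono j k j◁k rewrite rest j | rest k =
      monotone _ _ (subst₂ _◁_ (lookup-removeAt cs p j) (lookup-removeAt cs p k) j◁k)

  pred-injective : ∀ {a b} → 1 ≤ a → 1 ≤ b → pred a ≡ pred b → a ≡ b
  pred-injective (s≤s _) (s≤s _) = cong suc

  -- A standard filling of n+1 cells takes the value n+1 somewhere: otherwise
  -- pred ∘ T would inject n+1 positions into Fin n (pigeonhole).
  largestEntry : ∀ {n} {cs : Vec Cell (suc n)} {T} → IsStandard cs T → ∃ λ p → lookup T p ≡ suc n
  largestEntry {n} {T = T} st with any? (λ p → lookup T p ≟ suc n)
  ... | yes found = found
  ... | no none =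
    let i , j , i<j , same = pigeonhole ≤-refl index
    in contradiction (injective i j (same-entry i j same)) (FinP.<⇒≢ i<j)
    where
    open IsStandard st
    shrink : ∀ q → pred (lookup T q) < n
    shrink q with lookup T q | bounded q | none ∘ (q ,_)
    ... | suc v | _ , s≤s v≤n | v≢n = ≤∧≢⇒< v≤n (v≢n ∘ cong suc)
    index : Fin (suc n) → Fin n
    index q = fromℕ< (shrink q)
    same-entry : ∀ i j → index i ≡ index j → lookup T i ≡ lookup T j
    same-entry i j e = pred-injective (proj₁ (bounded i)) (proj₁ (bounded j))
      (trans (sym (toℕ-fromℕ< (shrink i))) (trans (cong toℕ e) (toℕ-fromℕ< (shrink j))))

  placeLargest : ∀ {n} (cs : Vec Cell (suc n)) (p : Fin (suc n)) → List (Vec ℕ n) → List (Vec ℕ (suc n))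
  placeLargest {n} cs p Ts = onlyIf (isCorner? (lookup cs p) (toList cs)) (map (λ T → insertAt T p (suc n)) Ts)

  mutual
    standardFillings : ∀ {n} → Vec Cell n → List (Vec ℕ n)
    standardFillings {zero}  []  = [ [] ]
    standardFillings {suc n} cs = concat (tabulate (withLargestAt cs))

    withLargestAt : ∀ {n} (cs : Vec Cell (suc n)) → Fin (suc n) → List (Vec ℕ (suc n))
    withLargestAt cs p = placeLargest cs p (standardFillings (removeAt cs p))

  placeLargest-sound : ∀ {n} (cs : Vec Cell (suc n)) p {Ts T} → (∀ {T'} → T' ∈ Ts → IsStandard (removeAt cs p) T') →
    T ∈ placeLargest cs p Ts → IsStandard cs T × lookup T p ≡ suc n
  placeLargest-sound {n} cs p sound T∈ with onlyIf-∈ (isCorner? (lookup cs p) (toList cs)) _ T∈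
  ... | corner , T∈map with ∈-map⁻ (λ T → insertAt T p (suc n)) T∈map
  ...   | T' , T'∈ , refl = placeLargest-standard cs p T' corner (sound T'∈) , insertAt-lookup T' p (suc n)

  ∈-placeLargest⁺ : ∀ {n} (cs : Vec Cell (suc n)) p {Ts T'} → IsCorner (lookup cs p) (toList cs) →
    T' ∈ Ts → insertAt T' p (suc n) ∈ placeLargest cs p Ts
  ∈-placeLargest⁺ {n} cs p corner T'∈ =
    subst (_ ∈_) (sym (onlyIf-yes (isCorner? (lookup cs p) (toList cs)) _ corner)) (∈-map⁺ (λ T → insertAt T p (suc n)) T'∈)

  standardFillings-sound : ∀ {n} (cs : Vec Cell n) {T} → T ∈ standardFillings cs → IsStandard cs T
  standardFillings-sound []          (here refl) = record { bounded = λ () ; injective = λ () ; monotone = λ () }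
  standardFillings-sound cs@(_ ∷ _) T∈ =
    let p , T∈p = AnyP.tabulate⁻ {f = withLargestAt cs} (∈-concat⁻ (tabulate (withLargestAt cs)) T∈)
    in proj₁ (placeLargest-sound cs p (standardFillings-sound (removeAt cs p)) T∈p)

  standardFillings-complete : ∀ {n} (cs : Vec Cell n) {T} → IsStandard cs T → T ∈ standardFillings cs
  standardFillings-complete []               {[]} _  = here refl
  standardFillings-complete {suc n} cs {T} st with largestEntry st
  ... | p , top = ∈-concat⁺ (AnyP.tabulate⁺ {f = withLargestAt cs} p placed)
    where
    T' : Vec ℕ n
    T' = removeAt T p
    restored : insertAt T' p (suc n) ≡ T
    restored = subst (λ v → insertAt T' p v ≡ T) top (insertAt-removeAt T p)
    placed : T ∈ withLargestAt cs p
    placed = subst (_∈ _) restored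
      (∈-placeLargest⁺ cs p (largest-at-corner p st top)
        (standardFillings-complete (removeAt cs p) (removeLargest-standard p st top)))

  -- Different positions of the largest entry give different fillings, so no
  -- filling is listed twice.
  standardFillings-unique : ∀ {n} (cs : Vec Cell n) → Unique (standardFillings cs)
  standardFillings-unique []                = All.[] ∷ []
  standardFillings-unique {suc n} cs =
    UniqueP.concat⁺ (AllP.tabulate⁺ each-unique) (AllPairsP.tabulate⁺ disjoint)
    where
    each-unique : ∀ p → Unique (withLargestAt cs p)
    each-unique p = onlyIf-unique _ (UniqueP.map⁺ insertAt-injective (standardFillings-unique (removeAt cs p)))
      where
      insertAt-injective : ∀ {T T' : Vec ℕ n} → insertAt T p (suc n) ≡ insertAt T' p (suc n) → T ≡ T'
      insertAt-injective {T} {T'} e =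
        trans (sym (removeAt-insertAt T p (suc n))) (trans (cong (λ v → removeAt v p) e) (removeAt-insertAt T' p (suc n)))
    disjoint : ∀ {p q} → p ≢ q → Disjoint (withLargestAt cs p) (withLargestAt cs q)
    disjoint {p} {q} p≢q (T∈p , T∈q) =
      let st , top-p = placeLargest-sound cs p (standardFillings-sound (removeAt cs p)) T∈p
          _  , top-q = placeLargest-sound cs q (standardFillings-sound (removeAt cs q)) T∈q
      in p≢q (IsStandard.injective st p q (trans top-p (sym top-q)))

  length-concat-tabulate : ∀ {A : Set} {n} (f : Fin n → List A) → length (concat (tabulate f)) ≡ sum (tabulate (length ∘ f))
  length-concat-tabulate {n = zero}  f = refl
  length-concat-tabulate {n = suc n} f = trans (length-++ (f Fin.zero)) (cong (length (f Fin.zero) +_) (length-concat-tabulate (f ∘ Fin.suc)))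

  -- For the list-based count below, D = pre ++ xs ++ post is traversed with
  -- a zipper: cornerSum f D pre xs post adds up f (D without x) over the
  -- cells x of xs that are corners of D.
  cornerSum : (List Cell → ℕ) → (D pre xs post : List Cell) → ℕ
  cornerSum f D pre []       post = 0
  cornerSum f D pre (x ∷ xs) post = onlyIfℕ (isCorner? x D) (f (pre ++ xs ++ post)) + cornerSum f D (pre ++ [ x ]) xs post

  -- peelings n D: the number of ways to delete n cells of D one at a time,
  -- each being a corner of what is left.  For n = length D this is the
  -- number of standard fillings of D (the deleted cells get n, n-1, …, 1).
  peelings : ℕ → List Cell → ℕ
  peelings zero    D = 1
  peelings (suc n) D = cornerSum (peelings n) D [] D []

  cornerSum-tabulate : ∀ (f : List Cell → ℕ) D pre {k} (xs : Vec Cell (suc k)) →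
    cornerSum f D pre (toList xs) [] ≡ sum (tabulate λ i → onlyIfℕ (isCorner? (lookup xs i) D) (f (pre ++ toList (removeAt xs i))))
  cornerSum-tabulate f D pre (x ∷ [])     = refl
  cornerSum-tabulate f D pre (x ∷ y ∷ ys) = cong₂ _+_
    (cong (λ l → onlyIfℕ (isCorner? x D) (f (pre ++ l))) (++-identityʳ (y ∷ toList ys)))
    (trans (cornerSum-tabulate f D (pre ++ [ x ]) (y ∷ ys))
      (cong sum (tabulate-cong λ i → cong (λ l → onlyIfℕ (isCorner? (lookup (y ∷ ys) i) D) (f l))
                                          (++-assoc pre [ x ] (toList (removeAt (y ∷ ys) i))))))

  length-standardFillings : ∀ {n} (cs : Vec Cell n) → length (standardFillings cs) ≡ peelings n (toList cs)
  length-standardFillings []          = refl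
  length-standardFillings {suc n} cs = begin
    length (concat (tabulate (withLargestAt cs)))
      ≡⟨ length-concat-tabulate (withLargestAt cs) ⟩
    sum (tabulate (length ∘ withLargestAt cs))
      ≡⟨ cong sum (tabulate-cong count-at) ⟩
    sum (tabulate λ p → onlyIfℕ (isCorner? (lookup cs p) (toList cs)) (peelings n (toList (removeAt cs p))))
      ≡⟨ cornerSum-tabulate (peelings n) (toList cs) [] cs ⟨
    peelings (suc n) (toList cs) ∎
    where
    count-at : ∀ p → length (withLargestAt cs p) ≡ onlyIfℕ (isCorner? (lookup cs p) (toList cs)) (peelings n (toList (removeAt cs p)))
    count-at p = trans (length-onlyIf (isCorner? (lookup cs p) (toList cs)) _)
      (cong (onlyIfℕ _) (trans (length-map _ (standardFillings (removeAt cs p))) (length-standardFillings (removeAt cs p))))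

  numStandardFillings : ∀ D → NumStandardFillings D (peelings (length D) D)
  numStandardFillings D =
      standardFillings (fromList D)
    , standardFillings-unique (fromList D)
    , (λ T → mk⇔ (standardFillings-complete (fromList D) ∘ Equivalence.to (isStandard⇔ D T))
                 (Equivalence.from (isStandard⇔ D T) ∘ standardFillings-sound (fromList D)))
    , trans (length-standardFillings (fromList D)) (cong (peelings (length D)) (toList∘fromList D))

-- The peeling recurrence for diagrams made of three left-justified rows.
module ThreeRows where

  open import Defs
  open Fillings
  open import Data.Nat using (ℕ; zero; suc; _+_; _≤_; _<_; z≤n; s≤s; _≤?_)
  open import Data.Nat.Properties using (≤-refl; <-≤-trans; ≤-<-trans; n≮n; ≮⇒≥; +-identityʳ; +-assoc)
  open import Data.List using (List; []; _∷_; _++_; [_]; map; upTo; length)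
  open import Data.List.Properties using (++-assoc; ++-identityʳ; map-++; upTo-∷ʳ; length-++; length-map; length-upTo)
  open import Data.List.Relation.Unary.All as All using (All)
  import Data.List.Relation.Unary.All.Properties as AllP
  open import Data.List.Membership.Propositional using (_∈_)
  open import Data.List.Membership.Propositional.Properties using (∈-++⁺ˡ; ∈-++⁺ʳ; ∈-map⁺; ∈-upTo⁺)
  open import Data.Product using (_×_; _,_)
  open import Data.Sum using (inj₁; inj₂)
  open import Relation.Nullary using (¬_)
  open import Relation.Nullary.Decidable using (_×-dec_)
  open import Relation.Binary.PropositionalEquality using (_≡_; refl; sym; trans; cong; cong₂; subst)
  open import Function.Bundles using (_⇔_; mk⇔)
  open Relation.Binary.PropositionalEquality.≡-Reasoning

  cornerSum-++ : ∀ f D pre xs ys post →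
    cornerSum f D pre (xs ++ ys) post ≡ cornerSum f D pre xs (ys ++ post) + cornerSum f D (pre ++ xs) ys post
  cornerSum-++ f D pre []       ys post = cong (λ l → cornerSum f D l ys post) (sym (++-identityʳ pre))
  cornerSum-++ f D pre (x ∷ xs) ys post
    rewrite ++-assoc xs ys post | cornerSum-++ f D (pre ++ [ x ]) xs ys post | ++-assoc pre [ x ] xs =
    sym (+-assoc (onlyIfℕ (isCorner? x D) (f (pre ++ xs ++ ys ++ post))) _ _)

  cornerSum-none : ∀ f D pre xs post → All (λ x → ¬ IsCorner x D) xs → cornerSum f D pre xs post ≡ 0
  cornerSum-none f D pre []       post All.[]       = refl
  cornerSum-none f D pre (x ∷ xs) post (¬c All.∷ ¬cs) =
    cong₂ _+_ (onlyIfℕ-no (isCorner? x D) _ ¬c) (cornerSum-none f D (pre ++ [ x ]) xs post ¬cs)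

  blocked : ∀ {x y D} → y ∈ D → x ◁ y → ¬ IsCorner x D
  blocked y∈D x◁y corner = All.lookup corner y∈D x◁y

  rowCells-snoc : ∀ i a → rowCells i (suc a) ≡ rowCells i a ++ [ (i , suc a) ]
  rowCells-snoc i a = trans (cong (map (λ j → (i , suc j))) (sym (upTo-∷ʳ a))) (map-++ (λ j → (i , suc j)) (upTo a) [ a ])

  ∈-rowCells : ∀ {i j a} → j < a → (i , suc j) ∈ rowCells i a
  ∈-rowCells j<a = ∈-map⁺ _ (∈-upTo⁺ j<a)

  all-rowCells : ∀ {P : Cell → Set} i a → (∀ j → j < a → P (i , suc j)) → All P (rowCells i a)
  all-rowCells i a P-row = AllP.map⁺ (AllP.applyUpTo⁺₁ _ a (λ {j} j<a → P-row j j<a))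

  clear-of-row : ∀ x i a → (i ≡ row x → a ≤ col x) → (row x < i → a < col x) → All (λ y → ¬ x ◁ y) (rowCells i a)
  clear-of-row x i a same below = all-rowCells i a λ where
    j j<a (inj₁ (x≡y , x<y)) → n≮n a (≤-<-trans (same (sym x≡y)) (<-≤-trans x<y j<a))
    j j<a (inj₂ (x≡y , x↑y)) → n≮n a (<-≤-trans (below x↑y) (subst (_≤ a) (sym x≡y) j<a))

  -- In a row only the last cell can be a corner: the others have a right
  -- neighbour.
  cornerSum-row : ∀ f D pre i a post → (i , suc a) ∈ D →
    cornerSum f D pre (rowCells i (suc a)) post ≡ onlyIfℕ (isCorner? (i , suc a) D) (f (pre ++ rowCells i a ++ post))
  cornerSum-row f D pre i a post end∈D = begin
    cornerSum f D pre (rowCells i (suc a)) post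
      ≡⟨ cong (λ l → cornerSum f D pre l post) (rowCells-snoc i a) ⟩
    cornerSum f D pre (rowCells i a ++ [ end ]) post
      ≡⟨ cornerSum-++ f D pre (rowCells i a) [ end ] post ⟩
    cornerSum f D pre (rowCells i a) ([ end ] ++ post) + cornerSum f D (pre ++ rowCells i a) [ end ] post
      ≡⟨ cong (_+ cornerSum f D (pre ++ rowCells i a) [ end ] post) (cornerSum-none f D pre (rowCells i a) _ (all-rowCells i a λ j j<a → blocked end∈D (inj₁ (refl , s≤s j<a)))) ⟩
    onlyIfℕ (isCorner? end D) (f ((pre ++ rowCells i a) ++ post)) + 0
      ≡⟨ +-identityʳ _ ⟩
    onlyIfℕ (isCorner? end D) (f ((pre ++ rowCells i a) ++ post))
      ≡⟨ cong (λ l → onlyIfℕ (isCorner? end D) (f l)) (++-assoc pre (rowCells i a) post) ⟩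
    onlyIfℕ (isCorner? end D) (f (pre ++ rowCells i a ++ post)) ∎
    where
    end : Cell
    end = (i , suc a)

  cornerSum-three : ∀ f A B C →
    cornerSum f (A ++ B ++ C) [] (A ++ B ++ C) [] ≡
      cornerSum f (A ++ B ++ C) [] A (B ++ C) + (cornerSum f (A ++ B ++ C) A B C + cornerSum f (A ++ B ++ C) (A ++ B) C [])
  cornerSum-three f A B C = begin
    cornerSum f D [] (A ++ B ++ C) []
      ≡⟨ cornerSum-++ f D [] A (B ++ C) [] ⟩
    cornerSum f D [] A ((B ++ C) ++ []) + cornerSum f D A (B ++ C) []
      ≡⟨ cong₂ _+_ (cong (cornerSum f D [] A) (++-identityʳ (B ++ C))) (cornerSum-++ f D A B C []) ⟩
    cornerSum f D [] A (B ++ C) + (cornerSum f D A B (C ++ []) + cornerSum f D (A ++ B) C [])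
      ≡⟨ cong (λ l → cornerSum f D [] A (B ++ C) + (cornerSum f D A B l + cornerSum f D (A ++ B) C [])) (++-identityʳ C) ⟩
    cornerSum f D [] A (B ++ C) + (cornerSum f D A B C + cornerSum f D (A ++ B) C []) ∎
    where
    D : List Cell
    D = A ++ B ++ C

  -- The left-justified diagram with rows of lengths a, b, c (not
  -- necessarily weakly decreasing).
  rows : ℕ → ℕ → ℕ → Diagram
  rows a b c = rowCells 1 a ++ rowCells 2 b ++ rowCells 3 c

  end₁-corner : ∀ a b c → IsCorner (1 , suc a) (rows (suc a) b c) ⇔ (b ≤ a × c ≤ a)
  end₁-corner a b c = mk⇔
    (λ corner → ≮⇒≥ (λ a<b → blocked (∈-++⁺ʳ (rowCells 1 (suc a)) (∈-++⁺ˡ (∈-rowCells a<b))) (inj₂ (refl , s≤s (s≤s z≤n))) corner)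
              , ≮⇒≥ (λ a<c → blocked (∈-++⁺ʳ (rowCells 1 (suc a)) (∈-++⁺ʳ (rowCells 2 b) (∈-rowCells a<c))) (inj₂ (refl , s≤s (s≤s z≤n))) corner))
    (λ (b≤a , c≤a) → AllP.++⁺ (clear-of-row _ 1 (suc a) (λ _ → ≤-refl) (λ { (s≤s ()) }))
                    (AllP.++⁺ (clear-of-row _ 2 b (λ ()) (λ _ → s≤s b≤a)) (clear-of-row _ 3 c (λ ()) (λ _ → s≤s c≤a))))

  end₂-corner : ∀ a b c → IsCorner (2 , suc b) (rows a (suc b) c) ⇔ c ≤ b
  end₂-corner a b c = mk⇔
    (λ corner → ≮⇒≥ (λ b<c → blocked (∈-++⁺ʳ (rowCells 1 a) (∈-++⁺ʳ (rowCells 2 (suc b)) (∈-rowCells b<c))) (inj₂ (refl , s≤s (s≤s (s≤s z≤n)))) corner))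
    (λ c≤b → AllP.++⁺ (clear-of-row _ 1 a (λ ()) (λ { (s≤s ()) }))
            (AllP.++⁺ (clear-of-row _ 2 (suc b) (λ _ → ≤-refl) (λ { (s≤s (s≤s ())) })) (clear-of-row _ 3 c (λ ()) (λ _ → s≤s c≤b))))

  end₃-corner : ∀ a b c → IsCorner (3 , suc c) (rows a b (suc c))
  end₃-corner a b c = AllP.++⁺ (clear-of-row _ 1 a (λ ()) (λ { (s≤s ()) }))
    (AllP.++⁺ (clear-of-row _ 2 b (λ ()) (λ { (s≤s (s≤s ())) })) (clear-of-row _ 3 (suc c) (λ _ → ≤-refl) (λ { (s≤s (s≤s (s≤s ()))) })))

  removeEnd₁ removeEnd₂ removeEnd₃ : ℕ → ℕ → ℕ → ℕ → ℕ
  removeEnd₁ n zero    b c = 0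
  removeEnd₁ n (suc a) b c = onlyIfℕ ((b ≤? a) ×-dec (c ≤? a)) (peelings n (rows a b c))
  removeEnd₂ n a zero    c = 0
  removeEnd₂ n a (suc b) c = onlyIfℕ (c ≤? b) (peelings n (rows a b c))
  removeEnd₃ n a b zero    = 0
  removeEnd₃ n a b (suc c) = peelings n (rows a b c)

  -- The peeling recurrence for three rows: the first deleted cell is the end
  -- of one of the rows.
  rows-recurrence : ∀ n a b c → peelings (suc n) (rows a b c) ≡ removeEnd₁ n a b c + (removeEnd₂ n a b c + removeEnd₃ n a b c)
  rows-recurrence n a b c =
    trans (cornerSum-three (peelings n) (rowCells 1 a) (rowCells 2 b) (rowCells 3 c)) (cong₂ _+_ (row₁ a) (cong₂ _+_ (row₂ b) (row₃ c)))
    where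
    row₁ : ∀ a → cornerSum (peelings n) (rows a b c) [] (rowCells 1 a) (rowCells 2 b ++ rowCells 3 c) ≡ removeEnd₁ n a b c
    row₁ zero    = refl
    row₁ (suc a) =
      trans (cornerSum-row (peelings n) (rows (suc a) b c) [] 1 a _ (∈-++⁺ˡ (∈-rowCells ≤-refl)))
            (onlyIfℕ-⇔ (isCorner? _ _) ((b ≤? a) ×-dec (c ≤? a)) _ (end₁-corner a b c))
    row₂ : ∀ b → cornerSum (peelings n) (rows a b c) (rowCells 1 a) (rowCells 2 b) (rowCells 3 c) ≡ removeEnd₂ n a b c
    row₂ zero    = refl
    row₂ (suc b) =
      trans (cornerSum-row (peelings n) (rows a (suc b) c) (rowCells 1 a) 2 b _ (∈-++⁺ʳ (rowCells 1 a) (∈-++⁺ˡ (∈-rowCells ≤-refl))))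
            (onlyIfℕ-⇔ (isCorner? _ _) (c ≤? b) _ (end₂-corner a b c))
    row₃ : ∀ c → cornerSum (peelings n) (rows a b c) (rowCells 1 a ++ rowCells 2 b) (rowCells 3 c) [] ≡ removeEnd₃ n a b c
    row₃ zero    = refl
    row₃ (suc c) =
      trans (cornerSum-row (peelings n) (rows a b (suc c)) (rowCells 1 a ++ rowCells 2 b) 3 c []
               (∈-++⁺ʳ (rowCells 1 a) (∈-++⁺ʳ (rowCells 2 b) (∈-rowCells ≤-refl))))
      (trans (onlyIfℕ-yes (isCorner? _ _) _ (end₃-corner a b c))
             (cong (peelings n) (trans (cong ((rowCells 1 a ++ rowCells 2 b) ++_) (++-identityʳ (rowCells 3 c))) (++-assoc (rowCells 1 a) (rowCells 2 b) (rowCells 3 c)))))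

  removeEnd₁-equal : ∀ n b c → removeEnd₁ n b b c ≡ 0
  removeEnd₁-equal n zero    c = refl
  removeEnd₁-equal n (suc b) c = onlyIfℕ-no ((suc b ≤? b) ×-dec (c ≤? b)) _ (λ (b<b , _) → n≮n b b<b)

  removeEnd₂-equal : ∀ n a c → removeEnd₂ n a c c ≡ 0
  removeEnd₂-equal n a zero    = refl
  removeEnd₂-equal n a (suc c) = onlyIfℕ-no (suc c ≤? c) _ (n≮n c)

  length-rowCells : ∀ i a → length (rowCells i a) ≡ a
  length-rowCells i a = trans (length-map _ (upTo a)) (length-upTo a)

  length-rows : ∀ a b c → length (rows a b c) ≡ a + b + c
  length-rows a b c = begin
    length (rowCells 1 a ++ rowCells 2 b ++ rowCells 3 c)        ≡⟨ length-++ (rowCells 1 a) ⟩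
    length (rowCells 1 a) + length (rowCells 2 b ++ rowCells 3 c) ≡⟨ cong (length (rowCells 1 a) +_) (length-++ (rowCells 2 b)) ⟩
    length (rowCells 1 a) + (length (rowCells 2 b) + length (rowCells 3 c))
      ≡⟨ cong₂ _+_ (length-rowCells 1 a) (cong₂ _+_ (length-rowCells 2 b) (length-rowCells 3 c)) ⟩
    a + (b + c)                                                  ≡⟨ +-assoc a b c ⟨
    a + b + c ∎

-- The hook length formula for partitions with at most three rows.
module HookLength where

  open Fillings
  open ThreeRows
  open import Data.Nat using (ℕ; zero; suc; _+_; _*_; _≤?_; _!)
  open import Data.Nat.Properties using (m≤n+m; ≤-trans; +-suc; suc-injective; *-assoc; *-comm; *-zeroʳ)
  open import Relation.Nullary.Decidable using (_×-dec_)
  open import Data.Nat.Tactic.RingSolver using (solve-∀)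
  open import Data.Product using (_,_)
  open import Relation.Binary.PropositionalEquality using (_≡_; refl; sym; trans; cong; cong₂)
  open Relation.Binary.PropositionalEquality.≡-Reasoning

  -- The hook length formula for a three-row partition λ = (a, b, c) in
  -- Frobenius' form  f^λ · l₁! l₂! l₃! = n! · ∏_{i<j} (lᵢ - lⱼ)  with
  -- l = (a+2, b+1, c).  Writing a = x + b and b = y + c the differences are
  -- x+1, x+y+2 and y+1.
  shiftedFactorials : ℕ → ℕ → ℕ → ℕ
  shiftedFactorials a b c = (2 + a) ! * ((1 + b) ! * c !)

  vandermonde : ℕ → ℕ → ℕ
  vandermonde x y = (x + 1) * (x + y + 2) * (y + 1)

  HookFormula : ℕ → Set
  HookFormula n = ∀ a b c x y → a + b + c ≡ n → a ≡ x + b → b ≡ y + c →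
    peelings n (rows a b c) * shiftedFactorials a b c ≡ n ! * vandermonde x y

  shiftedFactorials-suc₁ : ∀ a b c → shiftedFactorials (suc a) b c ≡ (3 + a) * shiftedFactorials a b c
  shiftedFactorials-suc₁ a b c = *-assoc (3 + a) ((2 + a) !) ((1 + b) ! * c !)

  shiftedFactorials-suc₂ : ∀ a b c → shiftedFactorials a (suc b) c ≡ (2 + b) * shiftedFactorials a b c
  shiftedFactorials-suc₂ a b c = reassoc ((2 + a) !) (2 + b) ((1 + b) !) (c !)
    where
    reassoc : ∀ A k B C → A * ((k * B) * C) ≡ k * (A * (B * C))
    reassoc = solve-∀

  shiftedFactorials-suc₃ : ∀ a b c → shiftedFactorials a b (suc c) ≡ suc c * shiftedFactorials a b c
  shiftedFactorials-suc₃ a b c = reassoc ((2 + a) !) ((1 + b) !) (suc c) (c !)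
    where
    reassoc : ∀ A B k C → A * (B * (k * C)) ≡ k * (A * (B * C))
    reassoc = solve-∀

  scale : ∀ u w F p k → u * w ≡ F * p → u * (k * w) ≡ F * (k * p)
  scale u w F p k e = begin
    u * (k * w) ≡⟨ swap u k w ⟩
    k * (u * w) ≡⟨ cong (k *_) e ⟩
    k * (F * p) ≡⟨ swap k F p ⟩
    F * (k * p) ∎
    where
    swap : ∀ m n o → m * (n * o) ≡ n * (m * o)
    swap = solve-∀

  vandermonde-step₁ : ∀ x y c → (3 + (x + (y + c))) * vandermonde x y ≡ suc x * ((2 + (suc x + (y + c))) * (suc x + y + 1) * (y + 1))
  vandermonde-step₁ = identity
    where
    identity : ∀ x y c → (3 + (x + (y + c))) * ((x + 1) * (x + y + 2) * (y + 1)) ≡ suc x * ((2 + (suc x + (y + c))) * (suc x + y + 1) * (y + 1))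
    identity = solve-∀

  vandermonde-step₂ : ∀ x y c → (2 + (y + c)) * vandermonde (suc x) y ≡ suc y * ((1 + (suc y + c)) * (x + 2) * (x + suc y + 2))
  vandermonde-step₂ = identity
    where
    identity : ∀ x y c → (2 + (y + c)) * ((suc x + 1) * (suc x + y + 2) * (y + 1)) ≡ suc y * ((1 + (suc y + c)) * (x + 2) * (x + suc y + 2))
    identity = solve-∀

  vandermonde-step₃ : ∀ x y → vandermonde x (suc y) ≡ (x + 1) * (x + y + 3) * (y + 2)
  vandermonde-step₃ = identity
    where
    identity : ∀ x y → (x + 1) * (x + suc y + 2) * (suc y + 1) ≡ (x + 1) * (x + y + 3) * (y + 2)
    identity = solve-∀

  -- The term of a row vanishes when its end
  -- is not a corner (x = 0, resp. y = 0) or the row is empty (c = 0).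
  end₁-term : ∀ {n} → HookFormula n → ∀ x y c → x + (y + c) + (y + c) + c ≡ suc n →
    removeEnd₁ n (x + (y + c)) (y + c) c * shiftedFactorials (x + (y + c)) (y + c) c
      ≡ n ! * (x * ((2 + (x + (y + c))) * (x + y + 1) * (y + 1)))
  end₁-term {n} ih zero y c _ = begin
    removeEnd₁ n (y + c) (y + c) c * _ ≡⟨ cong (_* shiftedFactorials (y + c) (y + c) c) (removeEnd₁-equal n (y + c) c) ⟩
    0                                 ≡⟨ *-zeroʳ (n !) ⟨
    n ! * 0 ∎
  end₁-term {n} ih (suc x) y c sz = begin
    removeEnd₁ n (suc a) b c * shiftedFactorials (suc a) b c
      ≡⟨ cong₂ _*_ (onlyIfℕ-yes ((b ≤? a) ×-dec (c ≤? a)) _ (m≤n+m b x , ≤-trans (m≤n+m c y) (m≤n+m b x)))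
                   (shiftedFactorials-suc₁ a b c) ⟩
    peelings n (rows a b c) * ((3 + a) * shiftedFactorials a b c)
      ≡⟨ scale (peelings n (rows a b c)) (shiftedFactorials a b c) (n !) (vandermonde x y) (3 + a) (ih a b c x y (suc-injective sz) refl refl) ⟩
    n ! * ((3 + a) * vandermonde x y)
      ≡⟨ cong (n ! *_) (vandermonde-step₁ x y c) ⟩
    n ! * (suc x * ((2 + (suc x + (y + c))) * (suc x + y + 1) * (y + 1))) ∎
    where
    a b : ℕ
    a = x + (y + c)
    b = y + c

  end₂-term : ∀ {n} → HookFormula n → ∀ x y c → x + (y + c) + (y + c) + c ≡ suc n →
    removeEnd₂ n (x + (y + c)) (y + c) c * shiftedFactorials (x + (y + c)) (y + c) c
      ≡ n ! * (y * ((1 + (y + c)) * (x + 2) * (x + y + 2)))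
  end₂-term {n} ih x zero c _ = begin
    removeEnd₂ n (x + c) c c * _ ≡⟨ cong (_* shiftedFactorials (x + c) c c) (removeEnd₂-equal n (x + c) c) ⟩
    0                            ≡⟨ *-zeroʳ (n !) ⟨
    n ! * 0 ∎
  end₂-term {n} ih x (suc y) c sz = begin
    removeEnd₂ n a (suc b) c * shiftedFactorials a (suc b) c
      ≡⟨ cong₂ _*_ (onlyIfℕ-yes (c ≤? b) _ (m≤n+m c y)) (shiftedFactorials-suc₂ a b c) ⟩
    peelings n (rows a b c) * ((2 + b) * shiftedFactorials a b c)
      ≡⟨ scale (peelings n (rows a b c)) (shiftedFactorials a b c) (n !) (vandermonde (suc x) y) (2 + b) (ih a b c (suc x) y sz′ (+-suc x b) refl) ⟩
    n ! * ((2 + b) * vandermonde (suc x) y)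
      ≡⟨ cong (n ! *_) (vandermonde-step₂ x y c) ⟩
    n ! * (suc y * ((1 + (suc y + c)) * (x + 2) * (x + suc y + 2))) ∎
    where
    a b : ℕ
    a = x + suc (y + c)
    b = y + c
    sz′ : a + b + c ≡ n
    sz′ = suc-injective (trans (cong (_+ c) (sym (+-suc a b))) sz)

  end₃-term : ∀ {n} → HookFormula n → ∀ x y c → x + (y + c) + (y + c) + c ≡ suc n →
    removeEnd₃ n (x + (y + c)) (y + c) c * shiftedFactorials (x + (y + c)) (y + c) c
      ≡ n ! * (c * ((x + 1) * (x + y + 3) * (y + 2)))
  end₃-term {n} ih x y zero    _  = sym (*-zeroʳ (n !))
  end₃-term {n} ih x y (suc c) sz = begin
    peelings n (rows a b c) * shiftedFactorials a b (suc c)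
      ≡⟨ cong (peelings n (rows a b c) *_) (shiftedFactorials-suc₃ a b c) ⟩
    peelings n (rows a b c) * (suc c * shiftedFactorials a b c)
      ≡⟨ scale (peelings n (rows a b c)) (shiftedFactorials a b c) (n !) (vandermonde x (suc y)) (suc c) (ih a b c x (suc y) sz′ refl (+-suc y c)) ⟩
    n ! * (suc c * vandermonde x (suc y))
      ≡⟨ cong (λ v → n ! * (suc c * v)) (vandermonde-step₃ x y) ⟩
    n ! * (suc c * ((x + 1) * (x + y + 3) * (y + 2))) ∎
    where
    a b : ℕ
    a = x + (y + suc c)
    b = y + suc c
    sz′ : a + b + c ≡ n
    sz′ = suc-injective (trans (sym (+-suc (a + b) c)) sz)

  terms-sum : ∀ x y c →
      x * ((2 + (x + (y + c))) * (x + y + 1) * (y + 1)) + (y * ((1 + (y + c)) * (x + 2) * (x + y + 2)) + c * ((x + 1) * (x + y + 3) * (y + 2)))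
    ≡ (x + (y + c) + (y + c) + c) * vandermonde x y
  terms-sum = identity
    where
    identity : ∀ x y c →
        x * ((2 + (x + (y + c))) * (x + y + 1) * (y + 1)) + (y * ((1 + (y + c)) * (x + 2) * (x + y + 2)) + c * ((x + 1) * (x + y + 3) * (y + 2)))
      ≡ (x + (y + c) + (y + c) + c) * ((x + 1) * (x + y + 2) * (y + 1))
    identity = solve-∀

  hook-formula : ∀ n → HookFormula n
  hook-formula zero zero zero zero zero zero refl refl refl = refl
  hook-formula (suc n) .(x + (y + c)) .(y + c) c x y sz refl refl = begin
    peelings (suc n) (rows a b c) * W
      ≡⟨ cong (_* W) (rows-recurrence n a b c) ⟩
    (removeEnd₁ n a b c + (removeEnd₂ n a b c + removeEnd₃ n a b c)) * W
      ≡⟨ distrib (removeEnd₁ n a b c) (removeEnd₂ n a b c) (removeEnd₃ n a b c) W ⟩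
    removeEnd₁ n a b c * W + (removeEnd₂ n a b c * W + removeEnd₃ n a b c * W)
      ≡⟨ cong₂ _+_ (end₁-term ih x y c sz) (cong₂ _+_ (end₂-term ih x y c sz) (end₃-term ih x y c sz)) ⟩
    n ! * t₁ + (n ! * t₂ + n ! * t₃)
      ≡⟨ factor (n !) t₁ t₂ t₃ ⟩
    n ! * (t₁ + (t₂ + t₃))
      ≡⟨ cong (n ! *_) (trans (terms-sum x y c) (cong (_* vandermonde x y) sz)) ⟩
    n ! * (suc n * vandermonde x y)
      ≡⟨ *-assoc (n !) (suc n) (vandermonde x y) ⟨
    n ! * suc n * vandermonde x y
      ≡⟨ cong (_* vandermonde x y) (*-comm (n !) (suc n)) ⟩
    suc n ! * vandermonde x y ∎
    where
    a b W t₁ t₂ t₃ : ℕ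
    a = x + (y + c)
    b = y + c
    W = shiftedFactorials a b c
    t₁ = x * ((2 + a) * (x + y + 1) * (y + 1))
    t₂ = y * ((1 + b) * (x + 2) * (x + y + 2))
    t₃ = c * ((x + 1) * (x + y + 3) * (y + 2))
    ih : HookFormula n
    ih = hook-formula n
    distrib : ∀ u v w W → (u + (v + w)) * W ≡ u * W + (v * W + w * W)
    distrib = solve-∀
    factor : ∀ F u v w → F * u + (F * v + F * w) ≡ F * (u + (v + w))
    factor = solve-∀

module MultinomialCoefficient where

  open import Defs
  open import Data.Nat using (_+_; _*_; _!)
  open import Data.Nat.Properties using (_!≢0; m*n≢0; _!*_!≢0; m+n∸m≡n; m≤m+n; *-cancelʳ-≡)
  open import Data.Nat.Divisibility using (_∣_; ∣-trans; *-monoˡ-∣)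
  open import Data.Nat.DivMod using (m/n*n≡m)
  open import Data.Nat.Combinatorics using (k![n∸k]!∣n!)
  open import Data.Nat.Tactic.RingSolver using (solve-∀)
  open import Relation.Binary.PropositionalEquality using (_≡_; cong; subst)
  open Relation.Binary.PropositionalEquality.≡-Reasoning

  multinomial-denominator-∣ : ∀ b c d → b ! * c ! * d ! ∣ (b + c + d) !
  multinomial-denominator-∣ b c d = ∣-trans
    (*-monoˡ-∣ (d !) (subst (λ z → b ! * z ! ∣ (b + c) !) (m+n∸m≡n b c) (k![n∸k]!∣n! (m≤m+n b c))))
    (subst (λ z → (b + c) ! * z ! ∣ (b + c + d) !) (m+n∸m≡n (b + c) d) (k![n∸k]!∣n! (m≤m+n (b + c) d)))

  multinomial-spec : ∀ b c d → multinomial b c d * (b ! * c ! * d !) ≡ (b + c + d) !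
  multinomial-spec b c d =
    m/n*n≡m {{m*n≢0 (b ! * c !) (d !) {{b !* c !≢0}} {{d !≢0}}}} (multinomial-denominator-∣ b c d)

  divide-by-multinomial : ∀ u p b c d → u * (b ! * c ! * d !) ≡ (b + c + d) ! * p → u ≡ multinomial b c d * p
  divide-by-multinomial u p b c d e = *-cancelʳ-≡ u (multinomial b c d * p) (b ! * c ! * d !)
    {{m*n≢0 (b ! * c !) (d !) {{b !* c !≢0}} {{d !≢0}}}}
    (begin
      u * (b ! * c ! * d !)                      ≡⟨ e ⟩
      (b + c + d) ! * p                          ≡⟨ cong (_* p) (multinomial-spec b c d) ⟨
      multinomial b c d * (b ! * c ! * d !) * p  ≡⟨ swap (multinomial b c d) (b ! * c ! * d !) p ⟩
      multinomial b c d * p * (b ! * c ! * d !)  ∎)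
    where
    swap : ∀ x y z → x * y * z ≡ x * z * y
    swap = solve-∀

-- Part (1): the shape (m+1, m+1, m-k) without its north-east corner,
-- i.e. the rows (m, m+1, m-k).
module Part1 where

  open import Defs
  open Fillings
  open ThreeRows
  open HookLength
  open MultinomialCoefficient
  open import Data.Nat using (ℕ; zero; suc; _+_; _*_; _∸_; _^_; _≤_; _≤?_; _!; z≤n; s≤s)
  open import Data.Nat.Properties using (n≮n; +-suc; +-identityʳ; +-comm; m≤m+n; m∸n+n≡m; ≤-pred; m≤n⇒m≤1+n)
  open import Data.Nat.Tactic.RingSolver using (solve-∀)
  open import Data.List using (length)
  open import Data.Product using (_×_; _,_; Σ)
  open import Relation.Nullary.Decidable using (_×-dec_)
  open import Relation.Binary.PropositionalEquality using (_≡_; refl; sym; trans; cong; cong₂)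
  open Relation.Binary.PropositionalEquality.≡-Reasoning

  fillings₁ : ℕ → ℕ → ℕ
  fillings₁ m c = peelings (m + suc m + c) (rows m (suc m) c)

  removeEnd₁-shorter : ∀ n m c → removeEnd₁ n m (suc m) c ≡ 0
  removeEnd₁-shorter n zero    c = refl
  removeEnd₁-shorter n (suc m) c = onlyIfℕ-no ((suc (suc m) ≤? m) ×-dec (c ≤? m)) _ (λ (m+2≤m , _) → n≮n m (≤-pred (m≤n⇒m≤1+n m+2≤m)))

  -- Peeling rows (m, m+1, c) with c ≤ m: the first deleted cell ends row 2,
  -- leaving the partition (m, m, c), or ends row 3.
  fillings₁-zero : ∀ m → fillings₁ m 0 ≡ peelings (m + m) (rows m m 0)
  fillings₁-zero m = begin
    peelings (m + suc m + 0) (rows m (suc m) 0)  ≡⟨ cong (λ n → peelings n (rows m (suc m) 0)) (trans (+-identityʳ _) (+-suc m m)) ⟩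
    peelings (suc (m + m)) (rows m (suc m) 0)    ≡⟨ rows-recurrence (m + m) m (suc m) 0 ⟩
    removeEnd₁ (m + m) m (suc m) 0 + (onlyIfℕ (0 ≤? m) (peelings (m + m) (rows m m 0)) + 0)
      ≡⟨ cong₂ _+_ (removeEnd₁-shorter (m + m) m 0) (trans (+-identityʳ _) (onlyIfℕ-yes (0 ≤? m) _ z≤n)) ⟩
    peelings (m + m) (rows m m 0) ∎

  fillings₁-suc : ∀ m c → suc c ≤ m → fillings₁ m (suc c) ≡ peelings (m + suc m + c) (rows m m (suc c)) + fillings₁ m c
  fillings₁-suc m c c<m = begin
    peelings (m + suc m + suc c) (rows m (suc m) (suc c))
      ≡⟨ cong (λ n → peelings n (rows m (suc m) (suc c))) (+-suc (m + suc m) c) ⟩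
    peelings (suc n) (rows m (suc m) (suc c))
      ≡⟨ rows-recurrence n m (suc m) (suc c) ⟩
    removeEnd₁ n m (suc m) (suc c) + (onlyIfℕ (suc c ≤? m) (peelings n (rows m m (suc c))) + fillings₁ m c)
      ≡⟨ cong₂ _+_ (removeEnd₁-shorter n m (suc c)) (cong (_+ fillings₁ m c) (onlyIfℕ-yes (suc c ≤? m) _ c<m)) ⟩
    peelings n (rows m m (suc c)) + fillings₁ m c ∎
    where
    n : ℕ
    n = m + suc m + c

  -- The two sides of formula (1), y = m - c being the parameter k.
  denominator₁ : ℕ → ℕ
  denominator₁ m = (m + 1) * (m + 2) * (2 * m + 1) * (2 * m + 3)

  numerator₁ : ℕ → ℕ → ℕ
  numerator₁ y m = (y + 2) ^ 2 * (2 * m + 1) + (m + 2)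

  -- The
  -- ring solver unfolds neither _!, _^_ nor named functions, so m!, c! enter
  -- as variables B, C while squares and shiftedFactorials are written out.
  base-rearrange : ∀ V B y →
    V * ((y + 1) * (y + 2) * (2 * y + 1) * (2 * y + 3)) * (B * (suc y * B) * 1)
      ≡ (2 * y + 1) * (2 * y + 3) * (V * ((suc (suc y) * (suc y * B)) * ((suc y * B) * 1)))
  base-rearrange = solve-∀

  base-identity : ∀ F y →
    (2 * y + 1) * (2 * y + 3) * (F * ((0 + 1) * (0 + y + 2) * (y + 1)))
      ≡ (suc (y + y) * F) * (((y + 2) * ((y + 2) * 1)) * (2 * y + 1) + (y + 2))
  base-identity = solve-∀

  step-rearrange : ∀ H G B C c m →
    (H + G) * ((m + 1) * (m + 2) * (2 * m + 1) * (2 * m + 3)) * (B * (suc m * B) * (suc c * C))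
      ≡ (2 * m + 1) * (2 * m + 3) * (H * ((suc (suc m) * (suc m * B)) * ((suc m * B) * (suc c * C))))
        + suc c * (G * ((m + 1) * (m + 2) * (2 * m + 1) * (2 * m + 3)) * (B * (suc m * B) * C))
  step-rearrange = solve-∀

  step-identity : ∀ F c y →
    (2 * suc (c + y) + 1) * (2 * suc (c + y) + 3) * (F * ((0 + 1) * (0 + y + 2) * (y + 1)))
      + suc c * (F * (((suc y + 2) * ((suc y + 2) * 1)) * (2 * suc (c + y) + 1) + (suc (c + y) + 2)))
    ≡ (suc (suc (c + y) + suc (suc (c + y)) + c) * F) * (((y + 2) * ((y + 2) * 1)) * (2 * suc (c + y) + 1) + (suc (c + y) + 2))
  step-identity = solve-∀

  -- Formula (1) with the multinomial denominator cleared, by induction on the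
  -- length c of row 3 (the rows (m, m, c) being counted by the hook formula).
  fillings₁-formula : ∀ c y m → m ≡ c + y →
    fillings₁ m c * denominator₁ m * (m ! * suc m ! * c !) ≡ (m + suc m + c) ! * numerator₁ y m
  fillings₁-formula zero y .y refl = begin
    fillings₁ y 0 * denominator₁ y * (y ! * suc y ! * 1)
      ≡⟨ cong (λ f → f * denominator₁ y * (y ! * suc y ! * 1)) (fillings₁-zero y) ⟩
    H * denominator₁ y * (y ! * suc y ! * 1)
      ≡⟨ base-rearrange H (y !) y ⟩
    (2 * y + 1) * (2 * y + 3) * (H * shiftedFactorials y y 0)
      ≡⟨ cong ((2 * y + 1) * (2 * y + 3) *_) (hook-formula (y + y) y y 0 0 y (+-identityʳ (y + y)) refl (sym (+-identityʳ y))) ⟩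
    (2 * y + 1) * (2 * y + 3) * ((y + y) ! * vandermonde 0 y)
      ≡⟨ base-identity ((y + y) !) y ⟩
    suc (y + y) ! * numerator₁ y y
      ≡⟨ cong (λ n → n ! * numerator₁ y y) (trans (+-identityʳ _) (+-suc y y)) ⟨
    (y + suc y + 0) ! * numerator₁ y y ∎
    where
    H : ℕ
    H = peelings (y + y) (rows y y 0)
  fillings₁-formula (suc c) y .(suc (c + y)) refl = begin
    fillings₁ m (suc c) * denominator₁ m * (m ! * suc m ! * suc c !)
      ≡⟨ cong (λ f → f * denominator₁ m * (m ! * suc m ! * suc c !)) (fillings₁-suc m c (s≤s (m≤m+n c y))) ⟩
    (H + fillings₁ m c) * denominator₁ m * (m ! * suc m ! * suc c !)
      ≡⟨ step-rearrange H (fillings₁ m c) (m !) (c !) c m ⟩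
    (2 * m + 1) * (2 * m + 3) * (H * shiftedFactorials m m (suc c)) + suc c * (fillings₁ m c * denominator₁ m * (m ! * suc m ! * c !))
      ≡⟨ cong₂ (λ u v → (2 * m + 1) * (2 * m + 3) * u + suc c * v) hook (fillings₁-formula c (suc y) m (sym (+-suc c y))) ⟩
    (2 * m + 1) * (2 * m + 3) * (n ! * vandermonde 0 y) + suc c * (n ! * numerator₁ (suc y) m)
      ≡⟨ step-identity (n !) c y ⟩
    suc n ! * numerator₁ y m
      ≡⟨ cong (λ n → n ! * numerator₁ y m) (+-suc (m + suc m) c) ⟨
    (m + suc m + suc c) ! * numerator₁ y m ∎
    where
    m n H : ℕ
    m = suc (c + y)
    n = m + suc m + c
    H = peelings n (rows m m (suc c))
    size : ∀ c y → suc (c + y) + suc (c + y) + suc c ≡ suc (c + y) + suc (suc (c + y)) + c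
    size = solve-∀
    hook : H * shiftedFactorials m m (suc c) ≡ n ! * vandermonde 0 y
    hook = hook-formula n m m (suc c) 0 y (size c y) refl (trans (cong suc (+-comm c y)) (sym (+-suc y c)))

  part1 : ∀ (m k : ℕ) → 1 ≤ m → k ≤ m →
    Σ ℕ λ f → NumStandardFillings (D₁ m k) f
      × f * ((m + 1) * (m + 2) * (2 * m + 1) * (2 * m + 3))
        ≡ multinomial m (m + 1) (m ∸ k) * ((k + 2) ^ 2 * (2 * m + 1) + (m + 2))
  part1 m k _ k≤m = peelings (length (D₁ m k)) (D₁ m k) , numStandardFillings (D₁ m k) , counted
    where
    counted : peelings (length (D₁ m k)) (D₁ m k) * denominator₁ m ≡ multinomial m (m + 1) (m ∸ k) * numerator₁ k m
    counted = begin
      peelings (length (D₁ m k)) (D₁ m k) * denominator₁ m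
        ≡⟨ cong (λ n → peelings n (D₁ m k) * denominator₁ m) (length-rows m (suc m) (m ∸ k)) ⟩
      fillings₁ m (m ∸ k) * denominator₁ m
        ≡⟨ divide-by-multinomial _ (numerator₁ k m) m (suc m) (m ∸ k) (fillings₁-formula (m ∸ k) k m (sym (m∸n+n≡m k≤m))) ⟩
      multinomial m (suc m) (m ∸ k) * numerator₁ k m
        ≡⟨ cong (λ b → multinomial m b (m ∸ k) * numerator₁ k m) (+-comm 1 m) ⟩
      multinomial m (m + 1) (m ∸ k) * numerator₁ k m ∎

-- Part (2): the shape (m+k, m, m) without the end of row 2, i.e. the rows
-- (m+k, m-1, m); first the formula multiplied out in ℕ.
module Part2 where

  open import Defs
  open Fillings
  open ThreeRows
  open HookLength
  open MultinomialCoefficient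
  open import Data.Nat using (ℕ; zero; suc; _+_; _*_; _≤_; _≤?_; _!)
  open import Data.Nat.Properties using (n≮n; +-suc; ≤-pred; m≤n⇒m≤1+n; m≤n+m; ≤-trans; n≤1+n)
  open import Data.Nat.Tactic.RingSolver using (solve-∀)
  open import Data.Product using (_,_)
  open import Relation.Nullary.Decidable using (_×-dec_)
  open import Relation.Binary.PropositionalEquality using (_≡_; refl; cong; cong₂)
  open Relation.Binary.PropositionalEquality.≡-Reasoning

  -- Normalisations and polynomial identities for the induction below, with
  -- m = d + 2 written out and the factorials d!, (k + m)! entering as the
  -- variables B, X (the ring solver does not unfold _!).
  base-rearrange₂ : ∀ N C B d →
    (N * ((2 * d + 3) * (2 * d + 1) * (3 * d + 5)) + 3 * C) * ((d + 0 + 4) * (d + 0 + 3))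
        * ((2 + d) * ((1 + d) * B) * ((1 + d) * B) * ((2 + d) * ((1 + d) * B)))
      ≡ (2 * d + 3) * (2 * d + 1) * (3 * d + 5)
          * (N * ((4 + d) * ((3 + d) * ((2 + d) * ((1 + d) * B))) * ((2 + d) * ((1 + d) * B) * ((1 + d) * B))))
        + 3 * (4 + d) * (1 + d) * (C * ((3 + d) * ((2 + d) * ((1 + d) * B)) * B * ((2 + d) * ((1 + d) * B))))
  base-rearrange₂ = solve-∀

  base-identity₂ : ∀ F d →
    (2 * d + 3) * (2 * d + 1) * (3 * d + 5) * (F * ((1 + 1) * (1 + 0 + 2) * (0 + 1)))
        + 3 * (4 + d) * (1 + d) * (suc (2 + d + suc d + suc d) * F)
      ≡ (suc (2 + d + suc d + suc d) * F) * (((0 + 2) * (0 + 2) * (2 * d + 1) + (d + 2)) * (3 * d + 5))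
  base-identity₂ = solve-∀

  step-rearrange₂ : ∀ g N C X S M d k →
    ((g + N) * ((2 * d + 3) * (2 * d + 1) * (3 * d + 5)) + 3 * C) * ((d + suc k + 4) * (d + suc k + 3))
        * (suc (k + suc (suc d)) * X * S * M)
      ≡ (d + k + 5) * ((g * ((2 * d + 3) * (2 * d + 1) * (3 * d + 5)) + 3 * C) * ((d + k + 4) * (d + k + 3)) * (X * S * M))
        + (2 * d + 3) * (2 * d + 1) * (3 * d + 5)
          * (N * (suc (suc (suc (k + suc (suc d)))) * (suc (suc (k + suc (suc d))) * (suc (k + suc (suc d)) * X)) * (M * S)))
  step-rearrange₂ = solve-∀

  step-identity₂ : ∀ F d k →
    (d + k + 5) * (F * (((k + 2) * (k + 2) * (2 * d + 1) + (d + 2)) * (3 * d + 5)))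
        + (2 * d + 3) * (2 * d + 1) * (3 * d + 5) * (F * ((suc (suc k) + 1) * (suc (suc k) + 0 + 2) * (0 + 1)))
      ≡ (suc (k + suc (suc d) + suc d + suc (suc d)) * F) * (((suc k + 2) * (suc k + 2) * (2 * d + 1) + (d + 2)) * (3 * d + 5))
  step-identity₂ = solve-∀

  -- Throughout m = d + 2, and row 1 has length k + m (k + m rather than
  -- m + k, so that lengthening row 1 is definitionally a successor).
  module _ (d : ℕ) where

    private
      m : ℕ
      m = suc (suc d)

    fillings₂ : ℕ → ℕ
    fillings₂ k = peelings (k + m + suc d + m) (rows (k + m) (suc d) m)

    partition₂ : ℕ → ℕ
    partition₂ k = peelings (k + m + suc d + suc d) (rows (k + m) (suc d) (suc d))

    removeEnd₂-longer : ∀ n a → removeEnd₂ n a (suc d) m ≡ 0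
    removeEnd₂-longer n a = onlyIfℕ-no (m ≤? d) _ (λ m≤d → n≮n d (≤-pred (m≤n⇒m≤1+n m≤d)))

    -- The end of row 1 is a corner iff row 1 is longer than row 3 (k > 0).
    fillings₂-zero : fillings₂ 0 ≡ partition₂ 0
    fillings₂-zero = begin
      peelings (suc n₀) (rows m (suc d) m)
        ≡⟨ rows-recurrence n₀ m (suc d) m ⟩
      removeEnd₁ n₀ m (suc d) m + (removeEnd₂ n₀ m (suc d) m + removeEnd₃ n₀ m (suc d) m)
        ≡⟨ cong₂ _+_ (onlyIfℕ-no ((suc d ≤? suc d) ×-dec (m ≤? suc d)) _ (λ (_ , m≤m-1) → n≮n (suc d) m≤m-1))
                     (cong (_+ removeEnd₃ n₀ m (suc d) m) (removeEnd₂-longer n₀ m)) ⟩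
      peelings n₀ (rows m (suc d) (suc d))
        ≡⟨ cong (λ n → peelings n (rows m (suc d) (suc d))) (+-suc (suc (d + suc d)) (suc d)) ⟩
      partition₂ 0 ∎
      where
      n₀ : ℕ
      n₀ = suc (d + suc d) + m

    fillings₂-suc : ∀ k → fillings₂ (suc k) ≡ fillings₂ k + partition₂ (suc k)
    fillings₂-suc k = begin
      peelings (suc n) (rows (suc (k + m)) (suc d) m)
        ≡⟨ rows-recurrence n (suc (k + m)) (suc d) m ⟩
      removeEnd₁ n (suc (k + m)) (suc d) m + (removeEnd₂ n (suc (k + m)) (suc d) m + removeEnd₃ n (suc (k + m)) (suc d) m)
        ≡⟨ cong₂ _+_ (onlyIfℕ-yes ((suc d ≤? k + m) ×-dec (m ≤? k + m)) _ (row₂-shorter , row₃-shorter))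
                     (cong (_+ removeEnd₃ n (suc (k + m)) (suc d) m) (removeEnd₂-longer n (suc (k + m)))) ⟩
      fillings₂ k + peelings n (rows (suc (k + m)) (suc d) (suc d))
        ≡⟨ cong (λ n → fillings₂ k + peelings n (rows (suc (k + m)) (suc d) (suc d))) (+-suc (k + m + suc d) (suc d)) ⟩
      fillings₂ k + partition₂ (suc k) ∎
      where
      n : ℕ
      n = k + m + suc d + m
      row₃-shorter : m ≤ k + m
      row₃-shorter = m≤n+m m k
      row₂-shorter : suc d ≤ k + m
      row₂-shorter = ≤-trans (n≤1+n (suc d)) row₃-shorter

    partition₂-hook : ∀ k → partition₂ k * shiftedFactorials (k + m) (suc d) (suc d) ≡ (k + m + suc d + suc d) ! * vandermonde (suc k) 0
    partition₂-hook k = hook-formula _ (k + m) (suc d) (suc d) (suc k) 0 refl (+-suc k (suc d)) refl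

    -- The parts of formula (2): (2m-1)(2m-3)(3m-1), (m+k+2)(m+k+1),
    -- ((k+2)²(2m-3) + m)(3m-1) and the constant multinomial (m+1, m-2, m).
    A₂ : ℕ
    A₂ = (2 * d + 3) * (2 * d + 1) * (3 * d + 5)

    R₂ : ℕ → ℕ
    R₂ k = (d + k + 4) * (d + k + 3)

    P₂ : ℕ → ℕ
    P₂ k = ((k + 2) * (k + 2) * (2 * d + 1) + (d + 2)) * (3 * d + 5)

    C₂ : ℕ
    C₂ = multinomial (suc m) d m

    fillings₂-formula : ∀ k → (fillings₂ k * A₂ + 3 * C₂) * R₂ k * ((k + m) ! * suc d ! * m !) ≡ (k + m + suc d + m) ! * P₂ k
    fillings₂-formula zero = begin
      (fillings₂ 0 * A₂ + 3 * C₂) * R₂ 0 * (m ! * suc d ! * m !)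
        ≡⟨ cong (λ f → (f * A₂ + 3 * C₂) * R₂ 0 * (m ! * suc d ! * m !)) fillings₂-zero ⟩
      (partition₂ 0 * A₂ + 3 * C₂) * R₂ 0 * (m ! * suc d ! * m !)
        ≡⟨ base-rearrange₂ (partition₂ 0) C₂ (d !) d ⟩
      A₂ * (partition₂ 0 * shiftedFactorials m (suc d) (suc d)) + 3 * (4 + d) * (1 + d) * (C₂ * (suc m ! * d ! * m !))
        ≡⟨ cong₂ (λ u v → A₂ * u + 3 * (4 + d) * (1 + d) * v) (partition₂-hook 0) (multinomial-spec (suc m) d m) ⟩
      A₂ * (n₀ ! * vandermonde 1 0) + 3 * (4 + d) * (1 + d) * (suc m + d + m) !
        ≡⟨ cong (λ n → A₂ * (n₀ ! * vandermonde 1 0) + 3 * (4 + d) * (1 + d) * n !) (size₁ d) ⟩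
      A₂ * (n₀ ! * vandermonde 1 0) + 3 * (4 + d) * (1 + d) * suc n₀ !
        ≡⟨ base-identity₂ (n₀ !) d ⟩
      suc n₀ ! * P₂ 0
        ≡⟨ cong (λ n → n ! * P₂ 0) (size₂ d) ⟨
      (m + suc d + m) ! * P₂ 0 ∎
      where
      n₀ : ℕ
      n₀ = m + suc d + suc d
      size₁ : ∀ d → suc (suc (suc d)) + d + suc (suc d) ≡ suc (suc (suc d) + suc d + suc d)
      size₁ = solve-∀
      size₂ : ∀ d → suc (suc d) + suc d + suc (suc d) ≡ suc (suc (suc d) + suc d + suc d)
      size₂ = solve-∀
    fillings₂-formula (suc k) = begin
      (fillings₂ (suc k) * A₂ + 3 * C₂) * R₂ (suc k) * (suc (k + m) ! * suc d ! * m !)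
        ≡⟨ cong (λ f → (f * A₂ + 3 * C₂) * R₂ (suc k) * (suc (k + m) ! * suc d ! * m !)) (fillings₂-suc k) ⟩
      ((fillings₂ k + partition₂ (suc k)) * A₂ + 3 * C₂) * R₂ (suc k) * (suc (k + m) ! * suc d ! * m !)
        ≡⟨ step-rearrange₂ (fillings₂ k) (partition₂ (suc k)) C₂ ((k + m) !) (suc d !) (m !) d k ⟩
      (d + k + 5) * ((fillings₂ k * A₂ + 3 * C₂) * R₂ k * ((k + m) ! * suc d ! * m !))
        + A₂ * (partition₂ (suc k) * shiftedFactorials (suc k + m) (suc d) (suc d))
        ≡⟨ cong₂ (λ u v → (d + k + 5) * u + A₂ * v) (fillings₂-formula k) (partition₂-hook (suc k)) ⟩
      (d + k + 5) * (n ! * P₂ k) + A₂ * ((suc k + m + suc d + suc d) ! * vandermonde (suc (suc k)) 0)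
        ≡⟨ cong (λ t → (d + k + 5) * (n ! * P₂ k) + A₂ * (t ! * vandermonde (suc (suc k)) 0)) (+-suc (k + m + suc d) (suc d)) ⟨
      (d + k + 5) * (n ! * P₂ k) + A₂ * (n ! * vandermonde (suc (suc k)) 0)
        ≡⟨ step-identity₂ (n !) d k ⟩
      suc n ! * P₂ (suc k) ∎
      where
      n : ℕ
      n = k + m + suc d + m

    fillings₂-count : ∀ k → (fillings₂ k * A₂ + 3 * C₂) * R₂ k ≡ multinomial (k + m) (suc d) m * P₂ k
    fillings₂-count k = divide-by-multinomial _ (P₂ k) (k + m) (suc d) m (fillings₂-formula k)

module Part2Integers where

  open import Defs
  open Fillings using (peelings; numStandardFillings)
  open ThreeRows using (rows; length-rows)
  open Part2 using (fillings₂; fillings₂-count; A₂; R₂; P₂)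
  open import Data.Nat as ℕ using (ℕ; suc; _∸_; _≤_; s≤s)
  open import Data.Nat.Properties using (+-comm)
  open import Data.List using (length)
  open import Data.Product using (_×_; _,_; Σ)
  open import Data.Integer using (+_; _-_) renaming (_*_ to _*ℤ_; _+_ to _+ℤ_)
  open import Data.Integer.Properties using (pos-*)
  open import Data.Integer.Tactic.RingSolver using (solve-∀)
  open import Relation.Binary.PropositionalEquality using (_≡_; sym; trans; cong; cong₂)
  open Relation.Binary.PropositionalEquality.≡-Reasoning

  -- The embedding ℕ → ℤ on the polynomials of formula (2).  Sums are
  -- embedded definitionally (+ (a + b) reduces to + a + + b); products need
  -- pos-*.
  cast-linear : ∀ a x b → + (a ℕ.* x ℕ.+ b) ≡ + a *ℤ + x +ℤ + b
  cast-linear a x b = cong (_+ℤ + b) (pos-* a x)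

  cast-left : ∀ f d k C →
    + ((f ℕ.* ((2 ℕ.* d ℕ.+ 3) ℕ.* (2 ℕ.* d ℕ.+ 1) ℕ.* (3 ℕ.* d ℕ.+ 5)) ℕ.+ 3 ℕ.* C) ℕ.* ((d ℕ.+ k ℕ.+ 4) ℕ.* (d ℕ.+ k ℕ.+ 3)))
      ≡ (+ f *ℤ ((+ 2 *ℤ + d +ℤ + 3) *ℤ (+ 2 *ℤ + d +ℤ + 1) *ℤ (+ 3 *ℤ + d +ℤ + 5)) +ℤ + 3 *ℤ + C)
        *ℤ ((+ d +ℤ + k +ℤ + 4) *ℤ (+ d +ℤ + k +ℤ + 3))
  cast-left f d k C =
    trans (pos-* (f ℕ.* A ℕ.+ 3 ℕ.* C) (r₁ ℕ.* r₂))
          (cong₂ _*ℤ_ (cong₂ _+ℤ_ (trans (pos-* f A) (cong (+ f *ℤ_) cast-A)) (pos-* 3 C)) (pos-* r₁ r₂))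
    where
    a₁ a₂ a₃ A r₁ r₂ : ℕ
    a₁ = 2 ℕ.* d ℕ.+ 3
    a₂ = 2 ℕ.* d ℕ.+ 1
    a₃ = 3 ℕ.* d ℕ.+ 5
    A = a₁ ℕ.* a₂ ℕ.* a₃
    r₁ = d ℕ.+ k ℕ.+ 4
    r₂ = d ℕ.+ k ℕ.+ 3
    cast-A : + A ≡ (+ 2 *ℤ + d +ℤ + 3) *ℤ (+ 2 *ℤ + d +ℤ + 1) *ℤ (+ 3 *ℤ + d +ℤ + 5)
    cast-A = trans (pos-* (a₁ ℕ.* a₂) a₃) (cong₂ _*ℤ_ (trans (pos-* a₁ a₂) (cong₂ _*ℤ_ (cast-linear 2 d 3) (cast-linear 2 d 1))) (cast-linear 3 d 5))

  cast-right : ∀ M d k →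
    + (M ℕ.* (((k ℕ.+ 2) ℕ.* (k ℕ.+ 2) ℕ.* (2 ℕ.* d ℕ.+ 1) ℕ.+ (d ℕ.+ 2)) ℕ.* (3 ℕ.* d ℕ.+ 5)))
      ≡ + M *ℤ (((+ k +ℤ + 2) *ℤ (+ k +ℤ + 2) *ℤ (+ 2 *ℤ + d +ℤ + 1) +ℤ (+ d +ℤ + 2)) *ℤ (+ 3 *ℤ + d +ℤ + 5))
  cast-right M d k = trans (pos-* M (Q ℕ.* a₃)) (cong (+ M *ℤ_) (trans (pos-* Q a₃) (cong₂ _*ℤ_ cast-Q (cast-linear 3 d 5))))
    where
    s a₂ a₃ Q : ℕ
    s = k ℕ.+ 2
    a₂ = 2 ℕ.* d ℕ.+ 1
    a₃ = 3 ℕ.* d ℕ.+ 5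
    Q = s ℕ.* s ℕ.* a₂ ℕ.+ (d ℕ.+ 2)
    cast-Q : + Q ≡ (+ k +ℤ + 2) *ℤ (+ k +ℤ + 2) *ℤ (+ 2 *ℤ + d +ℤ + 1) +ℤ (+ d +ℤ + 2)
    cast-Q = cong (_+ℤ (+ d +ℤ + 2)) (trans (pos-* (s ℕ.* s) a₂) (cong₂ _*ℤ_ (pos-* s s) (cast-linear 2 d 1)))

  solve-for-count : ∀ F D K M C →
    (F *ℤ ((+ 2 *ℤ D +ℤ + 3) *ℤ (+ 2 *ℤ D +ℤ + 1) *ℤ (+ 3 *ℤ D +ℤ + 5)) +ℤ + 3 *ℤ C) *ℤ ((D +ℤ K +ℤ + 4) *ℤ (D +ℤ K +ℤ + 3))
      ≡ M *ℤ (((K +ℤ + 2) *ℤ (K +ℤ + 2) *ℤ (+ 2 *ℤ D +ℤ + 1) +ℤ (D +ℤ + 2)) *ℤ (+ 3 *ℤ D +ℤ + 5)) →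
    F *ℤ ((+ 2 *ℤ (+ 2 +ℤ D) - + 1) *ℤ (+ 2 *ℤ (+ 2 +ℤ D) - + 3) *ℤ ((+ 2 +ℤ D) +ℤ K +ℤ + 2) *ℤ ((+ 2 +ℤ D) +ℤ K +ℤ + 1) *ℤ (+ 3 *ℤ (+ 2 +ℤ D) - + 1))
      ≡ ((K +ℤ + 2) *ℤ (K +ℤ + 2) *ℤ (+ 2 *ℤ (+ 2 +ℤ D) - + 3) +ℤ (+ 2 +ℤ D)) *ℤ (+ 3 *ℤ (+ 2 +ℤ D) - + 1) *ℤ M
        - + 3 *ℤ ((+ 2 +ℤ D) +ℤ K +ℤ + 2) *ℤ ((+ 2 +ℤ D) +ℤ K +ℤ + 1) *ℤ C
  solve-for-count F D K M C e = begin
    F *ℤ ((+ 2 *ℤ (+ 2 +ℤ D) - + 1) *ℤ (+ 2 *ℤ (+ 2 +ℤ D) - + 3) *ℤ ((+ 2 +ℤ D) +ℤ K +ℤ + 2) *ℤ ((+ 2 +ℤ D) +ℤ K +ℤ + 1) *ℤ (+ 3 *ℤ (+ 2 +ℤ D) - + 1))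
      ≡⟨ expand F D K C ⟩
    (F *ℤ ((+ 2 *ℤ D +ℤ + 3) *ℤ (+ 2 *ℤ D +ℤ + 1) *ℤ (+ 3 *ℤ D +ℤ + 5)) +ℤ + 3 *ℤ C) *ℤ ((D +ℤ K +ℤ + 4) *ℤ (D +ℤ K +ℤ + 3))
      - + 3 *ℤ C *ℤ ((D +ℤ K +ℤ + 4) *ℤ (D +ℤ K +ℤ + 3))
      ≡⟨ cong (_- + 3 *ℤ C *ℤ ((D +ℤ K +ℤ + 4) *ℤ (D +ℤ K +ℤ + 3))) e ⟩
    M *ℤ (((K +ℤ + 2) *ℤ (K +ℤ + 2) *ℤ (+ 2 *ℤ D +ℤ + 1) +ℤ (D +ℤ + 2)) *ℤ (+ 3 *ℤ D +ℤ + 5))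
      - + 3 *ℤ C *ℤ ((D +ℤ K +ℤ + 4) *ℤ (D +ℤ K +ℤ + 3))
      ≡⟨ collect D K M C ⟩
    ((K +ℤ + 2) *ℤ (K +ℤ + 2) *ℤ (+ 2 *ℤ (+ 2 +ℤ D) - + 3) +ℤ (+ 2 +ℤ D)) *ℤ (+ 3 *ℤ (+ 2 +ℤ D) - + 1) *ℤ M
      - + 3 *ℤ ((+ 2 +ℤ D) +ℤ K +ℤ + 2) *ℤ ((+ 2 +ℤ D) +ℤ K +ℤ + 1) *ℤ C ∎
    where
    expand : ∀ F D K C →
      F *ℤ ((+ 2 *ℤ (+ 2 +ℤ D) - + 1) *ℤ (+ 2 *ℤ (+ 2 +ℤ D) - + 3) *ℤ ((+ 2 +ℤ D) +ℤ K +ℤ + 2) *ℤ ((+ 2 +ℤ D) +ℤ K +ℤ + 1) *ℤ (+ 3 *ℤ (+ 2 +ℤ D) - + 1))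
        ≡ (F *ℤ ((+ 2 *ℤ D +ℤ + 3) *ℤ (+ 2 *ℤ D +ℤ + 1) *ℤ (+ 3 *ℤ D +ℤ + 5)) +ℤ + 3 *ℤ C) *ℤ ((D +ℤ K +ℤ + 4) *ℤ (D +ℤ K +ℤ + 3))
          - + 3 *ℤ C *ℤ ((D +ℤ K +ℤ + 4) *ℤ (D +ℤ K +ℤ + 3))
    expand = solve-∀
    collect : ∀ D K M C →
      M *ℤ (((K +ℤ + 2) *ℤ (K +ℤ + 2) *ℤ (+ 2 *ℤ D +ℤ + 1) +ℤ (D +ℤ + 2)) *ℤ (+ 3 *ℤ D +ℤ + 5))
        - + 3 *ℤ C *ℤ ((D +ℤ K +ℤ + 4) *ℤ (D +ℤ K +ℤ + 3))
        ≡ ((K +ℤ + 2) *ℤ (K +ℤ + 2) *ℤ (+ 2 *ℤ (+ 2 +ℤ D) - + 3) +ℤ (+ 2 +ℤ D)) *ℤ (+ 3 *ℤ (+ 2 +ℤ D) - + 1) *ℤ M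
          - + 3 *ℤ ((+ 2 +ℤ D) +ℤ K +ℤ + 2) *ℤ ((+ 2 +ℤ D) +ℤ K +ℤ + 1) *ℤ C
    collect = solve-∀

  part2 : ∀ (m k : ℕ) → 2 ≤ m →
    Σ ℕ λ f → NumStandardFillings (D₂ m k) f
      × (+ f) *ℤ ((+ 2 *ℤ + m - + 1) *ℤ (+ 2 *ℤ + m - + 3) *ℤ (+ m +ℤ + k +ℤ + 2) *ℤ (+ m +ℤ + k +ℤ + 1) *ℤ (+ 3 *ℤ + m - + 1))
        ≡ ((+ k +ℤ + 2) *ℤ (+ k +ℤ + 2) *ℤ (+ 2 *ℤ + m - + 3) +ℤ + m) *ℤ (+ 3 *ℤ + m - + 1) *ℤ + multinomial (m ℕ.+ k) (m ∸ 1) m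
          - + 3 *ℤ (+ m +ℤ + k +ℤ + 2) *ℤ (+ m +ℤ + k +ℤ + 1) *ℤ + multinomial (m ℕ.+ 1) (m ∸ 2) m
  part2 m@(suc (suc d)) k (s≤s (s≤s _)) =
    f , numStandardFillings (D₂ m k) ,
    solve-for-count (+ f) (+ d) (+ k) (+ M) (+ C) (trans (sym (cast-left f d k C)) (trans (cong +_ counted) (cast-right M d k)))
    where
    f M C : ℕ
    f = peelings (length (D₂ m k)) (D₂ m k)
    M = multinomial (m ℕ.+ k) (suc d) m
    C = multinomial (m ℕ.+ 1) d m
    f≡ : f ≡ fillings₂ d k
    f≡ = trans (cong (λ n → peelings n (D₂ m k)) (length-rows (m ℕ.+ k) (suc d) m))
               (cong (λ a → peelings (a ℕ.+ suc d ℕ.+ m) (rows a (suc d) m)) (+-comm m k))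
    counted : (f ℕ.* A₂ d ℕ.+ 3 ℕ.* C) ℕ.* R₂ d k ≡ M ℕ.* P₂ d k
    counted = trans (cong₂ (λ g c → (g ℕ.* A₂ d ℕ.+ 3 ℕ.* c) ℕ.* R₂ d k) f≡ (cong (λ b → multinomial b d m) (+-comm m 1)))
              (trans (fillings₂-count d k) (cong (λ a → multinomial a (suc d) m ℕ.* P₂ d k) (+-comm k m)))

module Part3 where

  open import Defs
  open Fillings
  open ThreeRows
  open import Data.Nat using (ℕ; zero; suc; _+_; _*_; _≤_; _≤?_; z≤n; s≤s)
  open import Data.Nat.Properties using (≤-refl; ≤-trans; ≮⇒≥; m≤m+n; +-identityʳ; +-suc; +-comm; *-cancelˡ-≡; *-distribˡ-+)
  open import Data.Nat.Tactic.RingSolver using (solve-∀)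
  open import Data.Nat.Combinatorics using (_C_; nCk+nC[k+1]≡[n+1]C[k+1]; nC1≡n)
  open import Data.List using (List; []; _∷_; _++_; [_]; length)
  open import Data.List.Properties using (++-assoc; ++-identityʳ; length-++)
  open import Data.List.Relation.Unary.All using (_∷_)
  import Data.List.Relation.Unary.All.Properties as AllP
  open import Data.List.Relation.Unary.Any using (here; there)
  open import Data.List.Membership.Propositional.Properties using (∈-++⁺ˡ; ∈-++⁺ʳ)
  open import Data.Product using (_×_; _,_; Σ)
  open import Data.Sum using (inj₁; inj₂)
  open import Relation.Nullary.Decidable using (_×-dec_)
  open import Relation.Binary.PropositionalEquality using (_≡_; refl; trans; cong; cong₂)
  open import Function.Bundles using (_⇔_; mk⇔)
  open Relation.Binary.PropositionalEquality.≡-Reasoning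

  middle : List Cell
  middle = (2 , 1) ∷ (2 , 3) ∷ []

  gapped : ℕ → ℕ → Diagram
  gapped a c = rowCells 1 a ++ middle ++ rowCells 3 c

  end₁-corner-gapped : ∀ t c → c ≤ 3 → IsCorner (1 , 4 + t) (gapped (4 + t) c)
  end₁-corner-gapped t c c≤3 = AllP.++⁺ (clear-of-row _ 1 (4 + t) (λ _ → ≤-refl) (λ { (s≤s ()) }))
    ((λ { (inj₁ (() , _)) ; (inj₂ (() , _)) }) ∷ (λ { (inj₁ (() , _)) ; (inj₂ (() , _)) }) ∷
     clear-of-row _ 3 c (λ ()) (λ _ → s≤s (≤-trans c≤3 (m≤m+n 3 t))))

  middle-corner-gapped : ∀ a c → IsCorner (2 , 3) (gapped a c) ⇔ c ≤ 2
  middle-corner-gapped a c = mk⇔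
    (λ corner → ≮⇒≥ (λ 2<c → blocked (∈-++⁺ʳ (rowCells 1 a) (∈-++⁺ʳ middle (∈-rowCells 2<c))) (inj₂ (refl , s≤s (s≤s (s≤s z≤n)))) corner))
    (λ c≤2 → AllP.++⁺ (clear-of-row _ 1 a (λ ()) (λ { (s≤s ()) }))
      ((λ { (inj₁ (_ , s≤s ())) ; (inj₂ (() , _)) }) ∷ (λ { (inj₁ (_ , s≤s (s≤s (s≤s ())))) ; (inj₂ (_ , s≤s (s≤s ()))) }) ∷
       clear-of-row _ 3 c (λ ()) (λ _ → s≤s c≤2)))

  end₃-corner-gapped : ∀ a c → IsCorner (3 , suc c) (gapped a (suc c))
  end₃-corner-gapped a c = AllP.++⁺ (clear-of-row _ 1 a (λ ()) (λ { (s≤s ()) }))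
    ((λ { (inj₁ (() , _)) ; (inj₂ (_ , s≤s (s≤s ()))) }) ∷ (λ { (inj₁ (() , _)) ; (inj₂ (_ , s≤s (s≤s ()))) }) ∷
     clear-of-row _ 3 (suc c) (λ _ → ≤-refl) (λ { (s≤s (s≤s (s≤s ()))) }))

  removeEnd₃-gapped : ℕ → ℕ → ℕ → ℕ
  removeEnd₃-gapped n a zero    = 0
  removeEnd₃-gapped n a (suc c) = peelings n (gapped a c)

  -- The peeling recurrence for gapped (4 + t) c, c ≤ 3; deleting (2,3)
  -- leaves the rows (4 + t, 1, c).
  gapped-recurrence : ∀ n t c → c ≤ 3 →
    peelings (suc n) (gapped (4 + t) c)
      ≡ peelings n (gapped (3 + t) c) + (onlyIfℕ (c ≤? 2) (peelings n (rows (4 + t) 1 c)) + removeEnd₃-gapped n (4 + t) c)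
  gapped-recurrence n t c c≤3 =
    trans (cornerSum-three (peelings n) (rowCells 1 (4 + t)) middle (rowCells 3 c)) (cong₂ _+_ row₁ (cong₂ _+_ row₂ (row₃ c)))
    where
    D : List Cell
    D = gapped (4 + t) c
    row₁ : cornerSum (peelings n) D [] (rowCells 1 (4 + t)) (middle ++ rowCells 3 c) ≡ peelings n (gapped (3 + t) c)
    row₁ = trans (cornerSum-row (peelings n) D [] 1 (3 + t) _ (∈-++⁺ˡ (∈-rowCells ≤-refl)))
                 (onlyIfℕ-yes (isCorner? _ D) _ (end₁-corner-gapped t c c≤3))
    row₂ : cornerSum (peelings n) D (rowCells 1 (4 + t)) middle (rowCells 3 c) ≡ onlyIfℕ (c ≤? 2) (peelings n (rows (4 + t) 1 c))
    row₂ = cong₂ _+_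
      (onlyIfℕ-no (isCorner? (2 , 1) D) _ (blocked (∈-++⁺ʳ (rowCells 1 (4 + t)) (there (here refl))) (inj₁ (refl , s≤s (s≤s z≤n)))))
      (trans (+-identityʳ _)
        (trans (onlyIfℕ-⇔ (isCorner? (2 , 3) D) (c ≤? 2) _ (middle-corner-gapped (4 + t) c))
               (cong (λ l → onlyIfℕ (c ≤? 2) (peelings n l)) (++-assoc (rowCells 1 (4 + t)) [ (2 , 1) ] (rowCells 3 c)))))
    row₃ : ∀ c → cornerSum (peelings n) (gapped (4 + t) c) (rowCells 1 (4 + t) ++ middle) (rowCells 3 c) [] ≡ removeEnd₃-gapped n (4 + t) c
    row₃ zero    = refl
    row₃ (suc c) =
      trans (cornerSum-row (peelings n) (gapped (4 + t) (suc c)) (rowCells 1 (4 + t) ++ middle) 3 c []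
              (∈-++⁺ʳ (rowCells 1 (4 + t)) (∈-++⁺ʳ middle (∈-rowCells ≤-refl))))
      (trans (onlyIfℕ-yes (isCorner? _ _) _ (end₃-corner-gapped (4 + t) c))
             (cong (peelings n) (trans (cong ((rowCells 1 (4 + t) ++ middle) ++_) (++-identityʳ (rowCells 3 c)))
                                       (++-assoc (rowCells 1 (4 + t)) middle (rowCells 3 c)))))

  single-row : ∀ a → peelings a (rows a 0 0) ≡ 1
  single-row zero    = refl
  single-row (suc a) = begin
    peelings (suc a) (rows (suc a) 0 0)                               ≡⟨ rows-recurrence a (suc a) 0 0 ⟩
    onlyIfℕ ((0 ≤? a) ×-dec (0 ≤? a)) (peelings a (rows a 0 0)) + 0   ≡⟨ +-identityʳ _ ⟩
    onlyIfℕ ((0 ≤? a) ×-dec (0 ≤? a)) (peelings a (rows a 0 0))       ≡⟨ onlyIfℕ-yes ((0 ≤? a) ×-dec (0 ≤? a)) _ (z≤n , z≤n) ⟩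
    peelings a (rows a 0 0)                                           ≡⟨ single-row a ⟩
    1 ∎

  gappedCount : ℕ → ℕ → ℕ
  gappedCount t c = peelings (3 + t + (2 + c)) (gapped (3 + t) c)

  rowsCount : ℕ → ℕ → ℕ
  rowsCount t c = peelings (3 + t + 1 + c) (rows (3 + t) 1 c)

  gappedBelow : ℕ → ℕ → ℕ
  gappedBelow t zero    = 0
  gappedBelow t (suc c) = gappedCount (suc t) c

  gappedCount-suc : ∀ t c → c ≤ 3 →
    gappedCount (suc t) c ≡ gappedCount t c + (onlyIfℕ (c ≤? 2) (rowsCount (suc t) c) + gappedBelow t c)
  gappedCount-suc t c c≤3 = trans (gapped-recurrence n t c c≤3)
    (cong (gappedCount t c +_) (cong₂ _+_ (cong (λ n → onlyIfℕ (c ≤? 2) (peelings n (rows (4 + t) 1 c))) (size t c)) (below c)))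
    where
    n : ℕ
    n = 3 + t + (2 + c)
    size : ∀ t c → 3 + t + (2 + c) ≡ 4 + t + 1 + c
    size = solve-∀
    below : ∀ c → removeEnd₃-gapped (3 + t + (2 + c)) (4 + t) c ≡ gappedBelow t c
    below zero    = refl
    below (suc c) = cong (λ n → peelings n (gapped (4 + t) c)) (+-suc (3 + t) (2 + c))

  -- Deleting first a cell of rows 2-3 of (4 + t, 1, c) leaves a single row
  -- (c = 0: the end of row 2) or shortens row 3.
  rowsBelow : ℕ → ℕ → ℕ
  rowsBelow t zero    = 1
  rowsBelow t (suc c) = rowsCount (suc t) c

  rowsCount-suc : ∀ t c → c ≤ 3 → rowsCount (suc t) c ≡ rowsCount t c + rowsBelow t c
  rowsCount-suc t zero _ = begin
    peelings (suc n) (rows (4 + t) 1 0)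
      ≡⟨ rows-recurrence n (4 + t) 1 0 ⟩
    onlyIfℕ ((1 ≤? 3 + t) ×-dec (0 ≤? 3 + t)) (rowsCount t 0) + (peelings n (rows (4 + t) 0 0) + 0)
      ≡⟨ cong₂ _+_ (onlyIfℕ-yes ((1 ≤? 3 + t) ×-dec (0 ≤? 3 + t)) _ (s≤s z≤n , z≤n))
                   (trans (+-identityʳ _) (trans (cong (λ n → peelings n (rows (4 + t) 0 0)) (size t)) (single-row (4 + t)))) ⟩
    rowsCount t 0 + 1 ∎
    where
    n : ℕ
    n = 3 + t + 1 + 0
    size : ∀ t → 3 + t + 1 + 0 ≡ 4 + t
    size = solve-∀
  rowsCount-suc t (suc c) c<3 = begin
    peelings (suc n) (rows (4 + t) 1 (suc c))
      ≡⟨ rows-recurrence n (4 + t) 1 (suc c) ⟩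
    onlyIfℕ ((1 ≤? 3 + t) ×-dec (suc c ≤? 3 + t)) (rowsCount t (suc c)) + (0 + peelings n (rows (4 + t) 1 c))
      ≡⟨ cong₂ _+_ (onlyIfℕ-yes ((1 ≤? 3 + t) ×-dec (suc c ≤? 3 + t)) _ (s≤s z≤n , ≤-trans c<3 (m≤m+n 3 t)))
                   (cong (λ n → peelings n (rows (4 + t) 1 c)) (size t c)) ⟩
    rowsCount t (suc c) + rowsCount (suc t) c ∎
    where
    n : ℕ
    n = 3 + t + 1 + suc c
    size : ∀ t c → 3 + t + 1 + suc c ≡ 4 + t + 1 + c
    size = solve-∀

  -- Each count is a polynomial in t; to stay in ℕ we determine 120 times it.
  -- The induction step adds up the recurrence.
  scaled-sum : ∀ F G {p q s} → 120 * F ≡ p → 120 * G ≡ q → p + q ≡ s → 120 * (F + G) ≡ s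
  scaled-sum F G {p} {q} eF eG e = begin
    120 * (F + G)      ≡⟨ *-distribˡ-+ 120 F G ⟩
    120 * F + 120 * G  ≡⟨ cong₂ _+_ eF eG ⟩
    p + q              ≡⟨ e ⟩
    _ ∎

  rowsCount₀ : ∀ t → 120 * rowsCount t 0 ≡ 120 * (3 + t)
  rowsCount₀ zero    = refl
  rowsCount₀ (suc t) = trans (cong (120 *_) (rowsCount-suc t 0 z≤n)) (scaled-sum (rowsCount t 0) 1 (rowsCount₀ t) refl (identity t))
    where
    identity : ∀ t → 120 * (3 + t) + 120 * 1 ≡ 120 * (3 + suc t)
    identity = solve-∀

  rowsCount₁ : ∀ t → 120 * rowsCount t 1 ≡ 60 * (12 + 7 * t + t * t)
  rowsCount₁ zero    = refl
  rowsCount₁ (suc t) = trans (cong (120 *_) (rowsCount-suc t 1 (s≤s z≤n)))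
    (scaled-sum (rowsCount t 1) (rowsCount (suc t) 0) (rowsCount₁ t) (rowsCount₀ (suc t)) (identity t))
    where
    identity : ∀ t → 60 * (12 + 7 * t + t * t) + 120 * (3 + suc t) ≡ 60 * (12 + 7 * suc t + suc t * suc t)
    identity = solve-∀

  rowsCount₂ : ∀ t → 120 * rowsCount t 2 ≡ 20 * (54 + 47 * t + 12 * (t * t) + t * t * t)
  rowsCount₂ zero    = refl
  rowsCount₂ (suc t) = trans (cong (120 *_) (rowsCount-suc t 2 (s≤s (s≤s z≤n))))
    (scaled-sum (rowsCount t 2) (rowsCount (suc t) 1) (rowsCount₂ t) (rowsCount₁ (suc t)) (identity t))
    where
    identity : ∀ t → 20 * (54 + 47 * t + 12 * (t * t) + t * t * t) + 60 * (12 + 7 * suc t + suc t * suc t)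
                   ≡ 20 * (54 + 47 * suc t + 12 * (suc t * suc t) + suc t * suc t * suc t)
    identity = solve-∀

  gappedCount₀ : ∀ t → 120 * gappedCount t 0 ≡ 60 * (6 + 7 * t + t * t)
  gappedCount₀ zero    = refl
  gappedCount₀ (suc t) = trans (cong (120 *_) (gappedCount-suc t 0 z≤n))
    (scaled-sum (gappedCount t 0) (rowsCount (suc t) 0 + 0) (gappedCount₀ t)
      (scaled-sum (rowsCount (suc t) 0) 0 (rowsCount₀ (suc t)) refl refl) (identity t))
    where
    identity : ∀ t → 60 * (6 + 7 * t + t * t) + (120 * (3 + suc t) + 0) ≡ 60 * (6 + 7 * suc t + suc t * suc t)
    identity = solve-∀

  gappedCount₁ : ∀ t → 120 * gappedCount t 1 ≡ 40 * (27 + 38 * t + 12 * (t * t) + t * t * t)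
  gappedCount₁ zero    = refl
  gappedCount₁ (suc t) = trans (cong (120 *_) (gappedCount-suc t 1 (s≤s z≤n)))
    (scaled-sum (gappedCount t 1) (rowsCount (suc t) 1 + gappedCount (suc t) 0) (gappedCount₁ t)
      (scaled-sum (rowsCount (suc t) 1) (gappedCount (suc t) 0) (rowsCount₁ (suc t)) (gappedCount₀ (suc t)) refl) (identity t))
    where
    identity : ∀ t → 40 * (27 + 38 * t + 12 * (t * t) + t * t * t)
                     + (60 * (12 + 7 * suc t + suc t * suc t) + 60 * (6 + 7 * suc t + suc t * suc t))
                   ≡ 40 * (27 + 38 * suc t + 12 * (suc t * suc t) + suc t * suc t * suc t)
    identity = solve-∀

  gappedCount₂ : ∀ t → 120 * gappedCount t 2 ≡ 15 * (144 + 234 * t + 107 * (t * t) + 18 * (t * t * t) + t * t * t * t)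
  gappedCount₂ zero    = refl
  gappedCount₂ (suc t) = trans (cong (120 *_) (gappedCount-suc t 2 (s≤s (s≤s z≤n))))
    (scaled-sum (gappedCount t 2) (rowsCount (suc t) 2 + gappedCount (suc t) 1) (gappedCount₂ t)
      (scaled-sum (rowsCount (suc t) 2) (gappedCount (suc t) 1) (rowsCount₂ (suc t)) (gappedCount₁ (suc t)) refl) (identity t))
    where
    identity : ∀ t → 15 * (144 + 234 * t + 107 * (t * t) + 18 * (t * t * t) + t * t * t * t)
                     + (20 * (54 + 47 * suc t + 12 * (suc t * suc t) + suc t * suc t * suc t)
                        + 40 * (27 + 38 * suc t + 12 * (suc t * suc t) + suc t * suc t * suc t))
                   ≡ 15 * (144 + 234 * suc t + 107 * (suc t * suc t) + 18 * (suc t * suc t * suc t) + suc t * suc t * suc t * suc t)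
    identity = solve-∀

  gappedCount₃ : ∀ t → 120 * gappedCount t 3 ≡ 3 * (720 + 1394 * t + 875 * (t * t) + 225 * (t * t * t) + 25 * (t * t * t * t) + t * t * t * t * t)
  gappedCount₃ zero    = refl
  gappedCount₃ (suc t) = trans (cong (120 *_) (gappedCount-suc t 3 ≤-refl))
    (scaled-sum (gappedCount t 3) (0 + gappedCount (suc t) 2) (gappedCount₃ t) (gappedCount₂ (suc t)) (identity t))
    where
    identity : ∀ t → 3 * (720 + 1394 * t + 875 * (t * t) + 225 * (t * t * t) + 25 * (t * t * t * t) + t * t * t * t * t)
                     + 15 * (144 + 234 * suc t + 107 * (suc t * suc t) + 18 * (suc t * suc t * suc t) + suc t * suc t * suc t * suc t)
                   ≡ 3 * (720 + 1394 * suc t + 875 * (suc t * suc t) + 225 * (suc t * suc t * suc t) + 25 * (suc t * suc t * suc t * suc t) + suc t * suc t * suc t * suc t * suc t)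
    identity = solve-∀

  choose-two : ∀ n → 2 * (suc n C 2) ≡ suc n * n
  choose-two zero    = refl
  choose-two (suc n) = begin
    2 * (suc (suc n) C 2)             ≡⟨ cong (2 *_) (nCk+nC[k+1]≡[n+1]C[k+1] (suc n) 1) ⟨
    2 * (suc n C 1 + suc n C 2)       ≡⟨ cong (λ x → 2 * (x + suc n C 2)) (nC1≡n (suc n)) ⟩
    2 * (suc n + suc n C 2)           ≡⟨ *-distribˡ-+ 2 (suc n) (suc n C 2) ⟩
    2 * suc n + 2 * (suc n C 2)       ≡⟨ cong (2 * suc n +_) (choose-two n) ⟩
    2 * suc n + suc n * n             ≡⟨ identity n ⟩
    suc (suc n) * suc n ∎
    where
    identity : ∀ n → 2 * suc n + suc n * n ≡ suc (suc n) * suc n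
    identity = solve-∀

  length-gapped : ∀ a c → length (gapped a c) ≡ a + (2 + c)
  length-gapped a c = trans (length-++ (rowCells 1 a)) (cong₂ _+_ (length-rowCells 1 a) (cong (2 +_) (length-rowCells 3 c)))

  part3 : ∀ (m : ℕ) → Σ ℕ λ f → NumStandardFillings (D₃ m) f × f * 10 ≡ (m + 5) * ((m + 2) C 2) * ((m + 9) C 2)
  part3 m = f , numStandardFillings (D₃ m) , *-cancelˡ-≡ (f * 10) ((m + 5) * ((m + 2) C 2) * ((m + 9) C 2)) 12 counted
    where
    f : ℕ
    f = peelings (length (D₃ m)) (D₃ m)
    f≡ : f ≡ gappedCount m 3
    f≡ = trans (cong (λ n → peelings n (D₃ m)) (length-gapped (m + 3) 3))
               (cong (λ a → peelings (a + (2 + 3)) (gapped a 3)) (+-comm m 3))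
    counted : 12 * (f * 10) ≡ 12 * ((m + 5) * ((m + 2) C 2) * ((m + 9) C 2))
    counted = begin
      12 * (f * 10)
        ≡⟨ regroup f ⟩
      120 * f
        ≡⟨ cong (120 *_) f≡ ⟩
      120 * gappedCount m 3
        ≡⟨ gappedCount₃ m ⟩
      3 * (720 + 1394 * m + 875 * (m * m) + 225 * (m * m * m) + 25 * (m * m * m * m) + m * m * m * m * m)
        ≡⟨ factorise m ⟩
      3 * ((m + 5) * (suc (suc m) * suc m) * (suc (8 + m) * (8 + m)))
        ≡⟨ cong₂ (λ u v → 3 * ((m + 5) * u * v)) (choose-two (suc m)) (choose-two (8 + m)) ⟨
      3 * ((m + 5) * (2 * ((2 + m) C 2)) * (2 * ((9 + m) C 2)))
        ≡⟨ cong₂ (λ u v → 3 * ((m + 5) * (2 * (u C 2)) * (2 * (v C 2)))) (+-comm 2 m) (+-comm 9 m) ⟩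
      3 * ((m + 5) * (2 * ((m + 2) C 2)) * (2 * ((m + 9) C 2)))
        ≡⟨ regroup₂ (m + 5) ((m + 2) C 2) ((m + 9) C 2) ⟩
      12 * ((m + 5) * ((m + 2) C 2) * ((m + 9) C 2)) ∎
      where
      regroup : ∀ f → 12 * (f * 10) ≡ 120 * f
      regroup = solve-∀
      factorise : ∀ m → 3 * (720 + 1394 * m + 875 * (m * m) + 225 * (m * m * m) + 25 * (m * m * m * m) + m * m * m * m * m)
                      ≡ 3 * ((m + 5) * (suc (suc m) * suc m) * (suc (8 + m) * (8 + m)))
      factorise = solve-∀
      regroup₂ : ∀ a u v → 3 * (a * (2 * u) * (2 * v)) ≡ 12 * (a * u * v)
      regroup₂ = solve-∀

open import Defs
open import Data.Nat using (ℕ; _+_; _*_; _∸_; _^_; _≤_)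
open import Data.Nat.Combinatorics using (_C_)
open import Data.Integer using (+_; _-_) renaming (_*_ to _*ℤ_; _+_ to _+ℤ_)
open import Data.Product using (_×_; _,_; Σ)
open import Relation.Binary.PropositionalEquality using (_≡_)
open Part1 using (part1)
open Part2Integers using (part2)
open Part3 using (part3)

theorem5p2 :
    -- (1)
    (∀ (m k : ℕ) → 1 ≤ m → k ≤ m →
      Σ ℕ λ f → NumStandardFillings (D₁ m k) f
        × f * ((m + 1) * (m + 2) * (2 * m + 1) * (2 * m + 3))
          ≡ multinomial m (m + 1) (m ∸ k) * ((k + 2) ^ 2 * (2 * m + 1) + (m + 2)))
    × -- (2)
    (∀ (m k : ℕ) → 2 ≤ m →
      Σ ℕ λ f → NumStandardFillings (D₂ m k) f
        × (+ f) *ℤ ((+ 2 *ℤ + m - + 1) *ℤ (+ 2 *ℤ + m - + 3) *ℤ (+ m +ℤ + k +ℤ + 2) *ℤ (+ m +ℤ + k +ℤ + 1) *ℤ (+ 3 *ℤ + m - + 1))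
          ≡ ((+ k +ℤ + 2) *ℤ (+ k +ℤ + 2) *ℤ (+ 2 *ℤ + m - + 3) +ℤ + m) *ℤ (+ 3 *ℤ + m - + 1) *ℤ + multinomial (m + k) (m ∸ 1) m
            - + 3 *ℤ (+ m +ℤ + k +ℤ + 2) *ℤ (+ m +ℤ + k +ℤ + 1) *ℤ + multinomial (m + 1) (m ∸ 2) m)
    × -- (3)
    (∀ (m : ℕ) →
      Σ ℕ λ f → NumStandardFillings (D₃ m) f
        × f * 10 ≡ (m + 5) * ((m + 2) C 2) * ((m + 9) C 2))
theorem5p2 = part1 , part2 , part3
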